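{- For every integer $n \geq 1$, the number $Z_{T_0}(n)$ of $T_0$-topologies $\mathcal{T}$ on $\{1,\ldots,n\}$ with covering dimension $\dim(\{1,\ldots,n\},\mathcal{T}) = 0$ satisfies \[ Z_{T_0}(n) = \sum_{\mathcal{P} \in \mathrm{Part}(n)} \ \prod_{A \in \mathcal{P},\, |A|>1} |A|\cdot P(|A|-1), \] where $\mathrm{Part}(n)$ is the set of all partitions of $\{1,\ldots,n\}$ and $P(k)$ is the number of partial orders on $\{1,\ldots,k\}$ (an empty product equals $1$).
   Context: A topology $\mathcal{T}$ on $X$ is $T_0$ if for any two distinct points $x,y$ there is an open set containing exactly one of them. A finite open covering of $(X,\mathcal{T})$ is a finite subset $\mathcal{A}\subseteq\mathcal{T}$ with $\bigcup\mathcal{A}=X$; $\mathcal{A}$ is finer than $\mathcal{B}$ if every $A\in\mathcal{A}$ is contained in some $B\in\mathcal{B}$. The order of a finite open covering $\mathcal{A}$ is the largest integer $m\geq -1$ such that $\mathcal{A}$ contains $m+1$ distinct sets with non-empty intersection. For $m\geq -1$, $\dim(X,\mathcal{T})\leq m$ means every finite open covering has a finer finite open covering of order $\leq m$; $\dim(X,\mathcal{T})=0$ means $\dim(X,\mathcal{T})\leq 0$ but not $\dim(X,\mathcal{T})\leq -1$ (the latter holds exactly for the empty space). -}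

module Defs where

open import Data.Nat using (ℕ; zero; suc; _*_; _∸_; _<ᵇ_)
open import Data.Bool using (Bool; true; false; if_then_else_; _∧_)
open import Data.Fin using (Fin)
open import Data.Fin.Subset using (Subset; _∈_; _∉_; _⊆_; _∪_; _∩_; ∣_∣; ⊤) renaming (⊥ to ∅)
open import Data.Vec using (Vec; []; _∷_; lookup)
open import Data.List using (List; [_]; _++_; map)
open import Data.Nat.ListAction using (product)
open import Data.Product using (Σ; _×_; _,_; ∃)
open import Data.Sum using (_⊎_)
open import Relation.Binary.PropositionalEquality using (_≡_; _≢_)
open import Relation.Nullary using (¬_)
open import Function.Definitions using (Injective)

-- Families of subsets of Fin n (= subsets of the power set), represented
-- canonically as a binary trie indexed by the characteristic vector.

Fam : ℕ → Set
Fam zero = Bool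
Fam (suc n) = Fam n × Fam n

memb : ∀ {n} → Fam n → Subset n → Bool
memb {zero} b [] = b
memb {suc n} (F₀ , F₁) (false ∷ A) = memb F₀ A
memb {suc n} (F₀ , F₁) (true ∷ A) = memb F₁ A

infix 4 _∈ᶠ_
_∈ᶠ_ : ∀ {n} → Subset n → Fam n → Set
A ∈ᶠ F = memb F A ≡ true

allSubsets : (n : ℕ) → List (Subset n)
allSubsets zero = [ [] ]
allSubsets (suc n) = map (false ∷_) (allSubsets n) ++ map (true ∷_) (allSubsets n)

-- Topologies on Fin n (a finite family, so closure under binary unions
-- and intersections together with ∅, X is the usual definition)

record IsTopology {n : ℕ} (𝒯 : Fam n) : Set where
  field
    empty-open : ∅ ∈ᶠ 𝒯
    full-open  : ⊤ ∈ᶠ 𝒯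
    ∪-open     : ∀ U V → U ∈ᶠ 𝒯 → V ∈ᶠ 𝒯 → (U ∪ V) ∈ᶠ 𝒯
    ∩-open     : ∀ U V → U ∈ᶠ 𝒯 → V ∈ᶠ 𝒯 → (U ∩ V) ∈ᶠ 𝒯

IsT₀ : ∀ {n} → Fam n → Set
IsT₀ {n} 𝒯 = ∀ (x y : Fin n) → x ≢ y →
  ∃ λ U → U ∈ᶠ 𝒯 × ((x ∈ U × y ∉ U) ⊎ (y ∈ U × x ∉ U))

IsOpenCovering : ∀ {n} → Fam n → Fam n → Set
IsOpenCovering {n} 𝒯 𝒜 =
  (∀ A → A ∈ᶠ 𝒜 → A ∈ᶠ 𝒯) × (∀ (x : Fin n) → ∃ λ A → A ∈ᶠ 𝒜 × x ∈ A)

Finer : ∀ {n} → Fam n → Fam n → Set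
Finer 𝒜 ℬ = ∀ A → A ∈ᶠ 𝒜 → ∃ λ B → B ∈ᶠ ℬ × A ⊆ B

-- OrderLe 𝒜 k  means  "order of 𝒜 ≤ k - 1"  (k = m + 1, m ≥ -1):
-- 𝒜 does not contain k + 1 = m + 2 distinct sets with non-empty intersection.
OrderLe : ∀ {n} → Fam n → ℕ → Set
OrderLe {n} 𝒜 k = ¬ (Σ (Fin (suc k) → Subset n) λ f →
  Injective _≡_ _≡_ f × (∀ i → f i ∈ᶠ 𝒜) × (∃ λ (x : Fin n) → ∀ i → x ∈ f i))

-- DimLe 𝒯 k  means  "dim (Fin n, 𝒯) ≤ k - 1"  (k = m + 1, m ≥ -1)
DimLe : ∀ {n} → Fam n → ℕ → Set
DimLe 𝒯 k = ∀ 𝒜 → IsOpenCovering 𝒯 𝒜 →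
  ∃ λ ℬ → IsOpenCovering 𝒯 ℬ × Finer ℬ 𝒜 × OrderLe ℬ k

Dim0 : ∀ {n} → Fam n → Set
Dim0 𝒯 = DimLe 𝒯 1 × ¬ DimLe 𝒯 0

-- T₀-topologies on Fin n of covering dimension 0 (proof fields irrelevant,
-- so elements are determined by the family of open sets)
record ZeroDimT₀Topology (n : ℕ) : Set where
  constructor mkZ
  field
    opens : Fam n
    .isTop : IsTopology opens
    .isT₀  : IsT₀ opens
    .dim0  : Dim0 opens

Rel : ℕ → Set
Rel k = Vec (Vec Bool k) k

_≤[_]_ : ∀ {k} → Fin k → Rel k → Fin k → Set
x ≤[ R ] y = lookup (lookup R x) y ≡ true

record PartialOrder (k : ℕ) : Set where
  constructor mkPO
  field
    rel : Rel k
    .reflexive : ∀ x → x ≤[ rel ] x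
    .antisym   : ∀ x y → x ≤[ rel ] y → y ≤[ rel ] x → x ≡ y
    .trans     : ∀ x y z → x ≤[ rel ] y → y ≤[ rel ] z → x ≤[ rel ] z

record Partition (n : ℕ) : Set where
  constructor mkPart
  field
    blocks : Fam n
    .nonempty : ∀ A → A ∈ᶠ blocks → ∃ λ (x : Fin n) → x ∈ A
    .disjoint : ∀ A B (x : Fin n) → A ∈ᶠ blocks → B ∈ᶠ blocks → x ∈ A → x ∈ B → A ≡ B
    .cover    : ∀ (x : Fin n) → ∃ λ A → A ∈ᶠ blocks × x ∈ A

weight : ∀ {n} → (ℕ → ℕ) → Partition n → ℕ
weight {n} P 𝒫 = product (map factor (allSubsets n))
  where
  factor : Subset n → ℕ
  factor A = if memb (Partition.blocks 𝒫) A ∧ (1 <ᵇ ∣ A ∣)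
             then ∣ A ∣ * P (∣ A ∣ ∸ 1) else 1

module Submission where

-- Zero-dimensional T₀-topologies on Fin n are counted by an explicit bijection
--   ZeroDimT₀Topology n ↔ Σ (𝒫 : Partition n) (Fin (weight P 𝒫)).
-- 1. A finite topology is the family of up-sets of its specialization order
--    (x ⊑ y iff every open set containing x contains y); T₀ makes ⊑ a partial
--    order, and every partial order arises.
-- 2. For the up-set topology of a partial order, dim ≤ 0 holds iff every point
--    lies above a unique minimal element: then the up-sets of the minimal
--    elements are a disjoint open covering refining every open covering;
--    conversely a refinement of order 0 separates minimal elements.  For n ≥ 1
--    dim ≤ -1 fails, so "dim = 0" is exactly this unique-minima property.
-- 3. Such an order is the same as a partition (its components ↑m, m minimal)
--    with a rooted order on every block of size > 1 (split / glue).
-- 4. Rooted orders on a k-element block ↔ rooted orders on Fin k ↔ pairs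
--    (root, partial order on the other k - 1 points): k · P (k - 1) of them.
-- 5. Turning the products and sums of the formula into Π- and Σ-types of
--    finite sets, the chain of bijections gives theorem2.

open import Defs
open import Data.Nat using (ℕ; zero; suc; _<_; _*_; _∸_; _<ᵇ_; _≤_; s≤s)
open import Data.Nat.Properties using (<-≤-trans; ≤-pred; ≤-refl; *-identityʳ)
open import Data.Nat.ListAction using (product)
open import Data.Nat.ListAction.Properties using (product-++)
open import Data.List using (map)
open import Data.List.Properties using (map-++; map-∘)
open import Data.Bool using (Bool; true; false; if_then_else_; _∧_; _∨_; not)
import Data.Bool as Bool
open import Data.Fin using (Fin; zero; suc; _≟_; punchIn; punchOut)
open import Data.Fin.Properties
  using (suc-injective; punchIn-injective; punchInᵢ≢i; punchIn-punchOut; 1↔⊤; +↔⊎; *↔×)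
open import Data.Fin.Subset using (Subset; _∈_; _⊂_; _∪_; _∩_; ∣_∣) renaming (⊥ to ∅; ⊤ to Full)
open import Data.Fin.Subset.Properties using (p⊂q⇒∣p∣<∣q∣)
open import Data.Vec using (Vec; []; _∷_; lookup; tabulate; sum)
open import Data.Vec.Properties using ([]=⇒lookup; lookup⇒[]=; lookup∘tabulate; lookup-zipWith; ≡-dec)
open import Data.Product using (Σ; _×_; _,_; ∃; proj₁; proj₂)
open import Data.Product.Function.NonDependent.Propositional using (_×-↔_)
open import Data.Product.Function.Dependent.Propositional using (Σ-↔)
open import Data.Sum using (_⊎_; inj₁; inj₂)
open import Data.Sum.Function.Propositional using (_⊎-↔_)
open import Data.Empty using (⊥; ⊥-elim)
open import Data.Unit using (⊤; tt)
open import Relation.Nullary using (¬_; Dec; yes; no; does; recompute)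
open import Relation.Nullary.Decidable using (dec-true; dec-false)
open import Relation.Binary.PropositionalEquality
  using (_≡_; refl; sym; trans; cong; cong₂; subst; module ≡-Reasoning)
open import Function.Bundles using (_↔_; mk↔ₛ′; Inverse)
open import Function.Properties.Inverse using (↔-refl; ↔-sym; ↔-trans)
open import Function.Related.Propositional using (module EquationalReasoning)

-- Boolean reflection.  Families of subsets and relations are Boolean data,
-- so propositions about them are stated as  b ≡ true.

∧-trueˡ : ∀ {a b} → (a ∧ b) ≡ true → a ≡ true
∧-trueˡ {true} p = refl

∧-trueʳ : ∀ {a b} → (a ∧ b) ≡ true → b ≡ true
∧-trueʳ {true} p = p

∧-intro : ∀ {a b} → a ≡ true → b ≡ true → (a ∧ b) ≡ true
∧-intro refl refl = refl

∧-elim₃ : ∀ {a b c} → (a ∧ (b ∧ c)) ≡ true → a ≡ true × b ≡ true × c ≡ true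
∧-elim₃ {true} {true} p = refl , refl , p

∨-elim : ∀ {a b} → (a ∨ b) ≡ true → (a ≡ true) ⊎ (b ≡ true)
∨-elim {true} p = inj₁ refl
∨-elim {false} p = inj₂ p

∨-introˡ : ∀ {a b} → a ≡ true → (a ∨ b) ≡ true
∨-introˡ refl = refl

∨-introʳ : ∀ {a b} → b ≡ true → (a ∨ b) ≡ true
∨-introʳ {true} p = refl
∨-introʳ {false} p = p

true≢false : ∀ {a} → a ≡ true → a ≡ false → ⊥
true≢false refl ()

¬true⇒false : ∀ {a} → ¬ (a ≡ true) → a ≡ false
¬true⇒false {true} p = ⊥-elim (p refl)
¬true⇒false {false} p = refl

bool-case : ∀ b → (b ≡ true) ⊎ (b ≡ false)
bool-case true = inj₁ refl
bool-case false = inj₂ refl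

bool-ext : ∀ {a b} → (a ≡ true → b ≡ true) → (b ≡ true → a ≡ true) → a ≡ b
bool-ext {true} {true} f g = refl
bool-ext {true} {false} f g = sym (f refl)
bool-ext {false} {true} f g = g refl
bool-ext {false} {false} f g = refl

infixr 5 _⇒ᵇ_
_⇒ᵇ_ : Bool → Bool → Bool
a ⇒ᵇ b = not a ∨ b

⇒ᵇ-elim : ∀ {a b} → (a ⇒ᵇ b) ≡ true → a ≡ true → b ≡ true
⇒ᵇ-elim {true} p refl = p

⇒ᵇ-intro : ∀ {a b} → (a ≡ true → b ≡ true) → (a ⇒ᵇ b) ≡ true
⇒ᵇ-intro {true} f = f refl
⇒ᵇ-intro {false} f = refl

does-sound : ∀ {A : Set} (a? : Dec A) → does a? ≡ true → A
does-sound (yes a) _ = a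

_==_ : ∀ {n} → Fin n → Fin n → Bool
x == y = does (x ≟ y)

==-refl : ∀ {n} (x : Fin n) → (x == x) ≡ true
==-refl x = dec-true (x ≟ x) refl

_≟ˢ_ : ∀ {n} (A B : Subset n) → Dec (A ≡ B)
_≟ˢ_ = ≡-dec Bool._≟_

_==ˢ_ : ∀ {n} → Subset n → Subset n → Bool
A ==ˢ B = does (A ≟ˢ B)

==ˢ-refl : ∀ {n} (A : Subset n) → (A ==ˢ A) ≡ true
==ˢ-refl A = dec-true (A ≟ˢ A) refl

∈⇒true : ∀ {n} {x : Fin n} {A : Subset n} → x ∈ A → lookup A x ≡ true
∈⇒true = []=⇒lookup

true⇒∈ : ∀ {n} {x : Fin n} {A : Subset n} → lookup A x ≡ true → x ∈ A
true⇒∈ {x = x} {A} = lookup⇒[]= x A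

lookup-∩ : ∀ {n} (A B : Subset n) x → lookup (A ∩ B) x ≡ (lookup A x ∧ lookup B x)
lookup-∩ A B x = lookup-zipWith _∧_ x A B

lookup-∪ : ∀ {n} (A B : Subset n) x → lookup (A ∪ B) x ≡ (lookup A x ∨ lookup B x)
lookup-∪ A B x = lookup-zipWith _∨_ x A B

lookup-Full : ∀ {n} (x : Fin n) → lookup Full x ≡ true
lookup-Full zero = refl
lookup-Full (suc x) = lookup-Full x

lookup-∅ : ∀ {n} (x : Fin n) → lookup ∅ x ≡ false
lookup-∅ zero = refl
lookup-∅ (suc x) = lookup-∅ x

vec-ext : ∀ {n} {A : Set} {a b : Vec A n} → (∀ i → lookup a i ≡ lookup b i) → a ≡ b
vec-ext {a = []} {[]} f = refl
vec-ext {a = x ∷ a} {y ∷ b} f = cong₂ _∷_ (f zero) (vec-ext (λ i → f (suc i)))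

allFin : ∀ {n} → (Fin n → Bool) → Bool
allFin {zero} p = true
allFin {suc n} p = p zero ∧ allFin (λ i → p (suc i))

allFin-elim : ∀ {n} {p : Fin n → Bool} → allFin p ≡ true → ∀ i → p i ≡ true
allFin-elim {suc n} q zero = ∧-trueˡ q
allFin-elim {suc n} {p} q (suc i) = allFin-elim {p = λ i → p (suc i)} (∧-trueʳ {p zero} q) i

allFin-intro : ∀ {n} {p : Fin n → Bool} → (∀ i → p i ≡ true) → allFin p ≡ true
allFin-intro {zero} f = refl
allFin-intro {suc n} f = ∧-intro (f zero) (allFin-intro (λ i → f (suc i)))

anyFin : ∀ {n} → (Fin n → Bool) → Bool
anyFin {zero} p = false
anyFin {suc n} p = p zero ∨ anyFin (λ i → p (suc i))

anyFin-elim : ∀ {n} {p : Fin n → Bool} → anyFin p ≡ true → ∃ λ i → p i ≡ true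
anyFin-elim {suc n} {p} q with ∨-elim {p zero} q
... | inj₁ r = zero , r
... | inj₂ r with anyFin-elim {p = λ i → p (suc i)} r
...   | i , s = suc i , s

anyFin-intro : ∀ {n} {p : Fin n → Bool} i → p i ≡ true → anyFin p ≡ true
anyFin-intro zero r = ∨-introˡ r
anyFin-intro {p = p} (suc i) r = ∨-introʳ {p zero} (anyFin-intro {p = λ i → p (suc i)} i r)

allSub : ∀ {n} → (Subset n → Bool) → Bool
allSub {zero} p = p []
allSub {suc n} p = allSub (λ A → p (false ∷ A)) ∧ allSub (λ A → p (true ∷ A))

allSub-elim : ∀ {n} {p : Subset n → Bool} → allSub p ≡ true → ∀ A → p A ≡ true
allSub-elim {zero} q [] = q
allSub-elim {suc n} {p} q (false ∷ A) = allSub-elim {p = λ A → p (false ∷ A)} (∧-trueˡ q) A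
allSub-elim {suc n} {p} q (true ∷ A) =
  allSub-elim {p = λ A → p (true ∷ A)} (∧-trueʳ {allSub (λ A → p (false ∷ A))} q) A

allSub-intro : ∀ {n} {p : Subset n → Bool} → (∀ A → p A ≡ true) → allSub p ≡ true
allSub-intro {zero} f = f []
allSub-intro {suc n} f = ∧-intro (allSub-intro (λ A → f (false ∷ A))) (allSub-intro (λ A → f (true ∷ A)))

anySub : ∀ {n} → (Subset n → Bool) → Bool
anySub {zero} p = p []
anySub {suc n} p = anySub (λ A → p (false ∷ A)) ∨ anySub (λ A → p (true ∷ A))

anySub-elim : ∀ {n} {p : Subset n → Bool} → anySub p ≡ true → ∃ λ A → p A ≡ true
anySub-elim {zero} q = [] , q
anySub-elim {suc n} {p} q with ∨-elim {anySub (λ A → p (false ∷ A))} q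
... | inj₁ r with anySub-elim {p = λ A → p (false ∷ A)} r
...   | A , s = false ∷ A , s
anySub-elim {suc n} {p} q | inj₂ r with anySub-elim {p = λ A → p (true ∷ A)} r
...   | A , s = true ∷ A , s

anySub-intro : ∀ {n} {p : Subset n → Bool} A → p A ≡ true → anySub p ≡ true
anySub-intro {zero} [] r = r
anySub-intro {suc n} {p} (false ∷ A) r = ∨-introˡ (anySub-intro {p = λ A → p (false ∷ A)} A r)
anySub-intro {suc n} {p} (true ∷ A) r =
  ∨-introʳ {anySub (λ A → p (false ∷ A))} (anySub-intro {p = λ A → p (true ∷ A)} A r)

famOf : ∀ {n} → (Subset n → Bool) → Fam n
famOf {zero} f = f []
famOf {suc n} f = famOf (λ A → f (false ∷ A)) , famOf (λ A → f (true ∷ A))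

memb-famOf : ∀ {n} (f : Subset n → Bool) A → memb (famOf f) A ≡ f A
memb-famOf {zero} f [] = refl
memb-famOf {suc n} f (false ∷ A) = memb-famOf (λ A → f (false ∷ A)) A
memb-famOf {suc n} f (true ∷ A) = memb-famOf (λ A → f (true ∷ A)) A

fam-ext : ∀ {n} {F G : Fam n} → (∀ A → memb F A ≡ memb G A) → F ≡ G
fam-ext {zero} f = f []
fam-ext {suc n} {F₀ , F₁} {G₀ , G₁} f =
  cong₂ _,_ (fam-ext (λ A → f (false ∷ A))) (fam-ext (λ A → f (true ∷ A)))

infix 30 _⟨_,_⟩
_⟨_,_⟩ : ∀ {k} → Rel k → Fin k → Fin k → Bool
R ⟨ x , y ⟩ = lookup (lookup R x) y

relOf : ∀ {k} → (Fin k → Fin k → Bool) → Rel k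
relOf f = tabulate (λ x → tabulate (λ y → f x y))

relOf-⟨⟩ : ∀ {k} (f : Fin k → Fin k → Bool) x y → relOf f ⟨ x , y ⟩ ≡ f x y
relOf-⟨⟩ f x y rewrite lookup∘tabulate (λ x → tabulate (λ y → f x y)) x = lookup∘tabulate (f x) y

rel-ext : ∀ {k} {R S : Rel k} → (∀ x y → R ⟨ x , y ⟩ ≡ S ⟨ x , y ⟩) → R ≡ S
rel-ext f = vec-ext (λ x → vec-ext (λ y → f x y))

-- Irrelevant equalities of decidable data can be recovered; this is how the
-- irrelevant proof fields of the records in Defs are used.
bool-irr : ∀ {a b : Bool} → .(a ≡ b) → a ≡ b
bool-irr {a} {b} p = recompute (a Bool.≟ b) p

fin-irr : ∀ {n} {x y : Fin n} → .(x ≡ y) → x ≡ y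
fin-irr {x = x} {y} p = recompute (x ≟ y) p

fam-irr : ∀ {n} {F G : Fam n} → .(F ≡ G) → F ≡ G
fam-irr p = fam-ext (λ A → bool-irr (cong (λ H → memb H A) p))

rel-irr : ∀ {k} {R S : Rel k} → .(R ≡ S) → R ≡ S
rel-irr {R = R} {S} p = recompute (≡-dec (≡-dec Bool._≟_) R S) p

module _ {n : ℕ} where

  Refl : Rel n → Set
  Refl R = ∀ x → R ⟨ x , x ⟩ ≡ true

  Antisym : Rel n → Set
  Antisym R = ∀ x y → R ⟨ x , y ⟩ ≡ true → R ⟨ y , x ⟩ ≡ true → x ≡ y

  Trans : Rel n → Set
  Trans R = ∀ x y z → R ⟨ x , y ⟩ ≡ true → R ⟨ y , z ⟩ ≡ true → R ⟨ x , z ⟩ ≡ true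

  Minimal : Rel n → Fin n → Set
  Minimal R m = ∀ y → R ⟨ y , m ⟩ ≡ true → y ≡ m

  LeastIn : Rel n → Subset n → Fin n → Set
  LeastIn R A r = ∀ y → lookup A y ≡ true → R ⟨ r , y ⟩ ≡ true

  UniqueMinima : Rel n → Set
  UniqueMinima R = ∀ x m m' → Minimal R m → Minimal R m' →
    R ⟨ m , x ⟩ ≡ true → R ⟨ m' , x ⟩ ≡ true → m ≡ m'

record UMinOrder (n : ℕ) : Set where
  constructor mkUMin
  field
    rel : Rel n
    .reflexive     : Refl rel
    .antisym       : Antisym rel
    .transitive    : Trans rel
    .unique-minima : UniqueMinima rel

UMinOrder-ext : ∀ {n} {a b : UMinOrder n} → UMinOrder.rel a ≡ UMinOrder.rel b → a ≡ b
UMinOrder-ext {a = mkUMin r _ _ _ _} {mkUMin .r _ _ _ _} refl = refl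

module _ {n : ℕ} where

  upSet : Rel n → Fin n → Subset n
  upSet R x = tabulate (λ z → R ⟨ x , z ⟩)

  lookup-upSet : ∀ (R : Rel n) x z → lookup (upSet R x) z ≡ R ⟨ x , z ⟩
  lookup-upSet R x z = lookup∘tabulate (λ z → R ⟨ x , z ⟩) z

  IsUp : Rel n → Subset n → Set
  IsUp R U = ∀ x y → lookup U x ≡ true → R ⟨ x , y ⟩ ≡ true → lookup U y ≡ true

  isUp : Rel n → Subset n → Bool
  isUp R U = allFin (λ x → allFin (λ y → (lookup U x ∧ R ⟨ x , y ⟩) ⇒ᵇ lookup U y))

  upSets : Rel n → Fam n
  upSets R = famOf (isUp R)

  upSets-elim : ∀ R {U} → U ∈ᶠ upSets R → IsUp R U
  upSets-elim R {U} p x y ux r =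
    ⇒ᵇ-elim (allFin-elim (allFin-elim (trans (sym (memb-famOf (isUp R) U)) p) x) y) (∧-intro ux r)

  upSets-intro : ∀ R {U} → IsUp R U → U ∈ᶠ upSets R
  upSets-intro R {U} f = trans (memb-famOf (isUp R) U)
    (allFin-intro (λ x → allFin-intro (λ y →
      ⇒ᵇ-intro (λ q → f x y (∧-trueˡ q) (∧-trueʳ {lookup U x} q)))))

  upSet-open : ∀ R → Trans R → ∀ x → upSet R x ∈ᶠ upSets R
  upSet-open R tr x = upSets-intro R (λ a b ua r →
    trans (lookup-upSet R x b) (tr x a b (trans (sym (lookup-upSet R x a)) ua) r))

  upSets-topology : ∀ R → IsTopology (upSets R)
  upSets-topology R = record
    { empty-open = upSets-intro R (λ x y ux _ → ⊥-elim (true≢false ux (lookup-∅ x)))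
    ; full-open  = upSets-intro R (λ x y _ _ → lookup-Full y)
    ; ∪-open     = λ U V u v → upSets-intro R (∪-up U V (upSets-elim R u) (upSets-elim R v))
    ; ∩-open     = λ U V u v → upSets-intro R (∩-up U V (upSets-elim R u) (upSets-elim R v))
    }
    where
    ∪-up : ∀ U V → IsUp R U → IsUp R V → IsUp R (U ∪ V)
    ∪-up U V u v x y ux r with ∨-elim {lookup U x} (trans (sym (lookup-∪ U V x)) ux)
    ... | inj₁ a = trans (lookup-∪ U V y) (∨-introˡ (u x y a r))
    ... | inj₂ b = trans (lookup-∪ U V y) (∨-introʳ {lookup U y} (v x y b r))
    ∩-up : ∀ U V → IsUp R U → IsUp R V → IsUp R (U ∩ V)
    ∩-up U V u v x y ux r = let q = trans (sym (lookup-∩ U V x)) ux in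
      trans (lookup-∩ U V y) (∧-intro (u x y (∧-trueˡ q) r) (v x y (∧-trueʳ {lookup U x} q) r))

  -- the up-set topology of a partial order is T₀: ↑x or ↑y separates x ≠ y
  upSets-T₀ : ∀ R → Refl R → Antisym R → Trans R → IsT₀ (upSets R)
  upSets-T₀ R rf an tr x y x≢y with R ⟨ x , y ⟩ in eq
  ... | true = upSet R y , upSet-open R tr y ,
               inj₂ (true⇒∈ (trans (lookup-upSet R y y) (rf y)) ,
                     λ y∈↑x → x≢y (an x y eq (trans (sym (lookup-upSet R y x)) (∈⇒true y∈↑x))))
  ... | false = upSet R x , upSet-open R tr x ,
                inj₁ (true⇒∈ (trans (lookup-upSet R x x) (rf x)) ,
                      λ y∈↑x → true≢false (trans (sym (lookup-upSet R x y)) (∈⇒true y∈↑x)) eq)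

module _ {n : ℕ} where

  specialization : Fam n → Rel n
  specialization 𝒯 = relOf (λ x y → allSub (λ U → (memb 𝒯 U ∧ lookup U x) ⇒ᵇ lookup U y))

  spec-elim : ∀ 𝒯 {x y} → specialization 𝒯 ⟨ x , y ⟩ ≡ true →
    ∀ U → U ∈ᶠ 𝒯 → lookup U x ≡ true → lookup U y ≡ true
  spec-elim 𝒯 {x} {y} p U o ux = ⇒ᵇ-elim (allSub-elim (trans (sym (relOf-⟨⟩ _ x y)) p) U) (∧-intro o ux)

  spec-intro : ∀ 𝒯 {x y} → (∀ U → U ∈ᶠ 𝒯 → lookup U x ≡ true → lookup U y ≡ true) →
    specialization 𝒯 ⟨ x , y ⟩ ≡ true
  spec-intro 𝒯 {x} {y} f =
    trans (relOf-⟨⟩ _ x y)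
      (allSub-intro (λ U → ⇒ᵇ-intro (λ q → f U (∧-trueˡ q) (∧-trueʳ {memb 𝒯 U} q))))

  spec-refl : ∀ 𝒯 → Refl (specialization 𝒯)
  spec-refl 𝒯 x = spec-intro 𝒯 (λ U o ux → ux)

  spec-trans : ∀ 𝒯 → Trans (specialization 𝒯)
  spec-trans 𝒯 x y z p q = spec-intro 𝒯 (λ U o ux → spec-elim 𝒯 q U o (spec-elim 𝒯 p U o ux))

  spec-antisym : ∀ 𝒯 → IsT₀ 𝒯 → Antisym (specialization 𝒯)
  spec-antisym 𝒯 t₀ x y p q with x ≟ y
  ... | yes x≡y = x≡y
  ... | no x≢y with t₀ x y x≢y
  ...   | U , o , inj₁ (x∈U , y∉U) = ⊥-elim (y∉U (true⇒∈ (spec-elim 𝒯 p U o (∈⇒true x∈U))))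
  ...   | U , o , inj₂ (y∈U , x∉U) = ⊥-elim (x∉U (true⇒∈ (spec-elim 𝒯 q U o (∈⇒true y∈U))))

  spec-upSets : ∀ R → Refl R → Trans R → specialization (upSets R) ≡ R
  spec-upSets R rf tr = rel-ext (λ x y → bool-ext
    (λ p → trans (sym (lookup-upSet R x y))
                 (spec-elim (upSets R) p (upSet R x) (upSet-open R tr x) (trans (lookup-upSet R x x) (rf x))))
    (λ r → spec-intro (upSets R) (λ U o ux → upSets-elim R o x y ux r)))

module _ {n : ℕ} where

  ⋂ˢ : ∀ {k} → (Subset k → Subset n) → Subset n
  ⋂ˢ {zero} f = f []
  ⋂ˢ {suc k} f = ⋂ˢ (λ A → f (false ∷ A)) ∩ ⋂ˢ (λ A → f (true ∷ A))

  ⋂ˢ-elim : ∀ {k} (f : Subset k → Subset n) y → lookup (⋂ˢ f) y ≡ true → ∀ A → lookup (f A) y ≡ true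
  ⋂ˢ-elim {zero} f y p [] = p
  ⋂ˢ-elim {suc k} f y p (false ∷ A) =
    ⋂ˢ-elim (λ A → f (false ∷ A)) y (∧-trueˡ (trans (sym (lookup-∩ (⋂ˢ (λ A → f (false ∷ A))) _ y)) p)) A
  ⋂ˢ-elim {suc k} f y p (true ∷ A) =
    ⋂ˢ-elim (λ A → f (true ∷ A)) y
      (∧-trueʳ {lookup (⋂ˢ (λ A → f (false ∷ A))) y} (trans (sym (lookup-∩ (⋂ˢ (λ A → f (false ∷ A))) _ y)) p)) A

  ⋂ˢ-intro : ∀ {k} (f : Subset k → Subset n) y → (∀ A → lookup (f A) y ≡ true) → lookup (⋂ˢ f) y ≡ true
  ⋂ˢ-intro {zero} f y g = g []
  ⋂ˢ-intro {suc k} f y g = trans (lookup-∩ (⋂ˢ (λ A → f (false ∷ A))) _ y)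
    (∧-intro (⋂ˢ-intro (λ A → f (false ∷ A)) y (λ A → g (false ∷ A)))
             (⋂ˢ-intro (λ A → f (true ∷ A)) y (λ A → g (true ∷ A))))

  ⋂ˢ-open : ∀ {𝒯 : Fam n} → IsTopology 𝒯 →
    ∀ {k} (f : Subset k → Subset n) → (∀ A → f A ∈ᶠ 𝒯) → ⋂ˢ f ∈ᶠ 𝒯
  ⋂ˢ-open t {zero} f o = o []
  ⋂ˢ-open t {suc k} f o = IsTopology.∩-open t _ _
    (⋂ˢ-open t (λ A → f (false ∷ A)) (λ A → o (false ∷ A)))
    (⋂ˢ-open t (λ A → f (true ∷ A)) (λ A → o (true ∷ A)))

  ⋃ᶠ : ∀ {k} → (Fin k → Subset n) → Subset n
  ⋃ᶠ {zero} f = ∅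
  ⋃ᶠ {suc k} f = f zero ∪ ⋃ᶠ (λ i → f (suc i))

  ⋃ᶠ-elim : ∀ {k} (f : Fin k → Subset n) y → lookup (⋃ᶠ f) y ≡ true → ∃ λ i → lookup (f i) y ≡ true
  ⋃ᶠ-elim {zero} f y p = ⊥-elim (true≢false p (lookup-∅ y))
  ⋃ᶠ-elim {suc k} f y p with ∨-elim {lookup (f zero) y} (trans (sym (lookup-∪ (f zero) _ y)) p)
  ... | inj₁ a = zero , a
  ... | inj₂ b with ⋃ᶠ-elim (λ i → f (suc i)) y b
  ...   | i , c = suc i , c

  ⋃ᶠ-intro : ∀ {k} (f : Fin k → Subset n) y i → lookup (f i) y ≡ true → lookup (⋃ᶠ f) y ≡ true
  ⋃ᶠ-intro {suc k} f y zero p = trans (lookup-∪ (f zero) _ y) (∨-introˡ p)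
  ⋃ᶠ-intro {suc k} f y (suc i) p =
    trans (lookup-∪ (f zero) _ y) (∨-introʳ {lookup (f zero) y} (⋃ᶠ-intro (λ i → f (suc i)) y i p))

  ⋃ᶠ-open : ∀ {𝒯 : Fam n} → IsTopology 𝒯 →
    ∀ {k} (f : Fin k → Subset n) → (∀ i → f i ∈ᶠ 𝒯) → ⋃ᶠ f ∈ᶠ 𝒯
  ⋃ᶠ-open t {zero} f o = IsTopology.empty-open t
  ⋃ᶠ-open t {suc k} f o = IsTopology.∪-open t _ _ (o zero) (⋃ᶠ-open t (λ i → f (suc i)) (λ i → o (suc i)))

-- The least open neighbourhood N x = ⋂ {V open | x ∈ V} of a point; its
-- points are exactly the specializations of x.
module LeastNeighbourhood {n : ℕ} (𝒯 : Fam n) (t : IsTopology 𝒯) where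

  nbhd : Fin n → Subset n → Subset n
  nbhd x V = if memb 𝒯 V ∧ lookup V x then V else Full

  N : Fin n → Subset n
  N x = ⋂ˢ (nbhd x)

  N-open : ∀ x → N x ∈ᶠ 𝒯
  N-open x = ⋂ˢ-open t (nbhd x) (λ V → nbhd-open V (memb 𝒯 V) refl)
    where
    nbhd-open : ∀ V b → memb 𝒯 V ≡ b → (if b ∧ lookup V x then V else Full) ∈ᶠ 𝒯
    nbhd-open V false _ = IsTopology.full-open t
    nbhd-open V true o with lookup V x
    ... | true = o
    ... | false = IsTopology.full-open t

  N-spec : ∀ x y → lookup (N x) y ≡ true → specialization 𝒯 ⟨ x , y ⟩ ≡ true
  N-spec x y p = spec-intro 𝒯 (λ V o vx →
    subst (λ W → lookup W y ≡ true) (nbhd-self V o vx) (⋂ˢ-elim (nbhd x) y p V))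
    where
    nbhd-self : ∀ V → memb 𝒯 V ≡ true → lookup V x ≡ true → nbhd x V ≡ V
    nbhd-self V o vx rewrite o | vx = refl

  x∈N : ∀ x → lookup (N x) x ≡ true
  x∈N x = ⋂ˢ-intro (nbhd x) x (λ V → x∈nbhd V (memb 𝒯 V ∧ lookup V x) refl)
    where
    x∈nbhd : ∀ V b → (memb 𝒯 V ∧ lookup V x) ≡ b → lookup (if b then V else Full) x ≡ true
    x∈nbhd V true e = ∧-trueʳ {memb 𝒯 V} e
    x∈nbhd V false e = lookup-Full x

-- A finite topology consists exactly of the up-sets of its specialization
-- order: an up-set U is the union of the least neighbourhoods of its points.
upSets-spec : ∀ {n} (𝒯 : Fam n) → IsTopology 𝒯 → upSets (specialization 𝒯) ≡ 𝒯
upSets-spec {n} 𝒯 t = fam-ext (λ U → bool-ext (up⇒open U)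
  (λ o → upSets-intro (specialization 𝒯) (λ x y ux r → spec-elim 𝒯 r U o ux)))
  where
  open LeastNeighbourhood 𝒯 t
  up⇒open : ∀ U → U ∈ᶠ upSets (specialization 𝒯) → U ∈ᶠ 𝒯
  up⇒open U up = subst (_∈ᶠ 𝒯) ⋃N≡U (⋃ᶠ-open t Nᵁ Nᵁ-open)
    where
    Nᵁ : Fin n → Subset n
    Nᵁ x = if lookup U x then N x else ∅
    Nᵁ-open : ∀ x → Nᵁ x ∈ᶠ 𝒯
    Nᵁ-open x with lookup U x
    ... | true = N-open x
    ... | false = IsTopology.empty-open t
    Nᵁ⊆U : ∀ {y} x → lookup (Nᵁ x) y ≡ true → lookup U y ≡ true
    Nᵁ⊆U {y} x r with lookup U x in ux
    ... | true = upSets-elim (specialization 𝒯) up x y ux (N-spec x y r)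
    ... | false = ⊥-elim (true≢false r (lookup-∅ y))
    ⋃N≡U : ⋃ᶠ Nᵁ ≡ U
    ⋃N≡U = vec-ext (λ y → bool-ext
      (λ q → let (x , r) = ⋃ᶠ-elim Nᵁ y q in Nᵁ⊆U x r)
      (λ uy → ⋃ᶠ-intro Nᵁ y y (subst (λ b → lookup (if b then N y else ∅) y ≡ true) (sym uy) (x∈N y))))

Disjoint : ∀ {n} → Fam n → Set
Disjoint {n} ℬ = ∀ B B' (x : Fin n) → B ∈ᶠ ℬ → B' ∈ᶠ ℬ → x ∈ B → x ∈ B' → B ≡ B'

module _ {n : ℕ} (R : Rel n) where

  isMinimal : Fin n → Bool
  isMinimal m = allFin (λ y → R ⟨ y , m ⟩ ⇒ᵇ (y == m))

  isMinimal-elim : ∀ {m} → isMinimal m ≡ true → Minimal R m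
  isMinimal-elim p y r = does-sound (y ≟ _) (⇒ᵇ-elim (allFin-elim p y) r)

  isMinimal-intro : ∀ {m} → Minimal R m → isMinimal m ≡ true
  isMinimal-intro {m} mm =
    allFin-intro (λ y → ⇒ᵇ-intro (λ r → subst (λ a → (y == a) ≡ true) (mm y r) (==-refl y)))

  isComponent : Subset n → Bool
  isComponent B = anyFin (λ m → isMinimal m ∧ (B ==ˢ upSet R m))

  components : Fam n
  components = famOf isComponent

  components-elim : ∀ {B} → B ∈ᶠ components → ∃ λ m → Minimal R m × B ≡ upSet R m
  components-elim {B} p with anyFin-elim {p = λ m → isMinimal m ∧ (B ==ˢ upSet R m)}
                               (trans (sym (memb-famOf isComponent B)) p)
  ... | m , q = m , isMinimal-elim (∧-trueˡ q) , does-sound (B ≟ˢ _) (∧-trueʳ {isMinimal m} q)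

  components-intro : ∀ {m} → Minimal R m → upSet R m ∈ᶠ components
  components-intro {m} mm = trans (memb-famOf isComponent (upSet R m))
    (anyFin-intro {p = λ m' → isMinimal m' ∧ (upSet R m ==ˢ upSet R m')} m
      (∧-intro (isMinimal-intro mm) (==ˢ-refl (upSet R m))))

module _ {n : ℕ} (R : Rel n) (rf : Refl R) (an : Antisym R) (tr : Trans R) where

  below : Fin n → Subset n
  below x = tabulate (λ y → R ⟨ y , x ⟩ ∧ not (y == x))

  lookup-below : ∀ x y → lookup (below x) y ≡ (R ⟨ y , x ⟩ ∧ not (y == x))
  lookup-below x y = lookup∘tabulate (λ y → R ⟨ y , x ⟩ ∧ not (y == x)) y

  below-⊂ : ∀ x y → R ⟨ y , x ⟩ ≡ true → (y == x) ≡ false → below y ⊂ below x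
  below-⊂ x y ryx y≢x = below-⊆ , y , true⇒∈ y∈below-x , y∉below-y
    where
    below-⊆ : ∀ {z} → z ∈ below y → z ∈ below x
    below-⊆ {z} z∈ with ∧-trueˡ (trans (sym (lookup-below y z)) (∈⇒true z∈))
                       | ∧-trueʳ {R ⟨ z , y ⟩} (trans (sym (lookup-below y z)) (∈⇒true z∈))
    ... | rzy | z≢y =
      true⇒∈ (trans (lookup-below x z) (∧-intro (tr z y x rzy ryx) (cong not (dec-false (z ≟ x) z≢x))))
      where
      z≢x : ¬ z ≡ x
      z≢x refl = true≢false (subst (λ a → (y == a) ≡ true) (an y z ryx rzy) (==-refl y)) y≢x
    y∈below-x : lookup (below x) y ≡ true
    y∈below-x = trans (lookup-below x y) (trans (cong (R ⟨ y , x ⟩ ∧_) (cong not y≢x)) (cong (_∧ true) ryx))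
    y∉below-y : ¬ y ∈ below y
    y∉below-y y∈ = true≢false (∧-trueʳ {R ⟨ y , y ⟩} (trans (sym (lookup-below y y)) (∈⇒true y∈)))
                              (cong not (==-refl y))

  minimal-below′ : ∀ k x → ∣ below x ∣ < k → ∃ λ m → Minimal R m × R ⟨ m , x ⟩ ≡ true
  minimal-below′ (suc k) x lt with anyFin (λ y → R ⟨ y , x ⟩ ∧ not (y == x)) in eq
  ... | false = x , x-minimal , rf x
    where
    x-minimal : Minimal R x
    x-minimal y r with y ≟ x
    ... | yes y≡x = y≡x
    ... | no y≢x = ⊥-elim (true≢false (anyFin-intro {p = λ y → R ⟨ y , x ⟩ ∧ not (y == x)} y
                                        (∧-intro r (cong not (dec-false (y ≟ x) y≢x)))) eq)
  ... | true with anyFin-elim {p = λ y → R ⟨ y , x ⟩ ∧ not (y == x)} eq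
  ...   | y , q with minimal-below′ k y (<-≤-trans (p⊂q⇒∣p∣<∣q∣ (below-⊂ x y (∧-trueˡ q) y≢x)) (≤-pred lt))
    where
    y≢x : (y == x) ≡ false
    y≢x = ¬true⇒false (λ e → true≢false (∧-trueʳ {R ⟨ y , x ⟩} q) (cong not e))
  ...     | m , mm , rmy = m , mm , tr m y x rmy (∧-trueˡ q)

  minimal-below : ∀ x → ∃ λ m → Minimal R m × R ⟨ m , x ⟩ ≡ true
  minimal-below x = minimal-below′ (suc ∣ below x ∣) x (s≤s ≤-refl)

  m∈↑m : ∀ m → lookup (upSet R m) m ≡ true
  m∈↑m m = trans (lookup-upSet R m m) (rf m)

  components-nonempty : ∀ A → A ∈ᶠ components R → ∃ λ (x : Fin n) → x ∈ A
  components-nonempty A A∈ with components-elim R A∈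
  ... | m , _ , refl = m , true⇒∈ (m∈↑m m)

  components-disjoint : UniqueMinima R → Disjoint (components R)
  components-disjoint um A C x A∈ C∈ x∈A x∈C with components-elim R A∈ | components-elim R C∈
  ... | m , mm , refl | m' , mm' , refl = cong (upSet R) (um x m m' mm mm'
        (trans (sym (lookup-upSet R m x)) (∈⇒true x∈A)) (trans (sym (lookup-upSet R m' x)) (∈⇒true x∈C)))

  components-cover : ∀ (x : Fin n) → ∃ λ A → A ∈ᶠ components R × x ∈ A
  components-cover x with minimal-below x
  ... | m , mm , r = upSet R m , components-intro R mm , true⇒∈ (trans (lookup-upSet R m x) r)

-- A non-empty space does not have dimension ≤ -1: the covering {Fin n} has no
-- refinement of order ≤ -1, since any point lies in some member of it.
nonempty⇒¬dim≤-1 : ∀ {n} (𝒯 : Fam n) → IsTopology 𝒯 → Fin n → ¬ DimLe 𝒯 0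
nonempty⇒¬dim≤-1 𝒯 t x₀ dim≤-1
  with dim≤-1 𝒯 ((λ A o → o) , λ x → Full , IsTopology.full-open t , true⇒∈ (lookup-Full x))
... | ℬ , (_ , ℬ-covers) , _ , order≤-1 with ℬ-covers x₀
...   | B , B∈ℬ , x₀∈B = order≤-1 ((λ _ → B) , injective₁ , (λ _ → B∈ℬ) , x₀ , λ _ → x₀∈B)
  where
  injective₁ : ∀ {i j : Fin 1} → B ≡ B → i ≡ j
  injective₁ {zero} {zero} _ = refl

disjoint⇒order≤0 : ∀ {n} (ℬ : Fam n) → Disjoint ℬ → OrderLe ℬ 1
disjoint⇒order≤0 ℬ disjoint (f , f-inj , f∈ , x , x∈f)
  with f-inj {zero} {suc zero} (disjoint _ _ x (f∈ zero) (f∈ (suc zero)) (x∈f zero) (x∈f (suc zero)))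
... | ()

order≤0⇒disjoint : ∀ {n} (ℬ : Fam n) → OrderLe ℬ 1 → Disjoint ℬ
order≤0⇒disjoint ℬ order≤0 B B' x B∈ B'∈ x∈B x∈B' with B ≟ˢ B'
... | yes B≡B' = B≡B'
... | no B≢B' = ⊥-elim (order≤0 (pair , pair-injective , pair∈ , x , x∈pair))
  where
  pair : Fin 2 → Subset _
  pair zero = B
  pair (suc _) = B'
  pair-injective : ∀ {i j : Fin 2} → pair i ≡ pair j → i ≡ j
  pair-injective {zero} {zero} _ = refl
  pair-injective {zero} {suc zero} e = ⊥-elim (B≢B' e)
  pair-injective {suc zero} {zero} e = ⊥-elim (B≢B' (sym e))
  pair-injective {suc zero} {suc zero} _ = refl
  pair∈ : ∀ i → pair i ∈ᶠ ℬ
  pair∈ zero = B∈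
  pair∈ (suc _) = B'∈
  x∈pair : ∀ i → x ∈ pair i
  x∈pair zero = x∈B
  x∈pair (suc _) = x∈B'

module _ {n : ℕ} (R : Rel n) (rf : Refl R) (an : Antisym R) (tr : Trans R) where

  ↑-elim : ∀ {m z B} → B ≡ upSet R m → lookup B z ≡ true → R ⟨ m , z ⟩ ≡ true
  ↑-elim {m} {z} refl p = trans (sym (lookup-upSet R m z)) p

  -- With unique minima the components form a disjoint open covering refining
  -- every open covering (each open set containing a minimal m contains ↑m).
  unique-minima⇒dim≤0 : UniqueMinima R → DimLe (upSets R) 1
  unique-minima⇒dim≤0 um 𝒜 (𝒜-open , 𝒜-covers) =
    components R , (components-open , components-cover R rf an tr) , finer ,
    disjoint⇒order≤0 (components R) (components-disjoint R rf an tr um)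
    where
    components-open : ∀ B → B ∈ᶠ components R → B ∈ᶠ upSets R
    components-open B B∈ with components-elim R B∈
    ... | m , _ , refl = upSet-open R tr m
    finer : Finer (components R) 𝒜
    finer B B∈ with components-elim R B∈
    ... | m , _ , B≡↑m with 𝒜-covers m
    ...   | A , A∈𝒜 , m∈A = A , A∈𝒜 , λ {z} z∈B →
              true⇒∈ (upSets-elim R (𝒜-open A A∈𝒜) m z (∈⇒true m∈A) (↑-elim B≡↑m (∈⇒true z∈B)))

  isPrincipal : Subset n → Bool
  isPrincipal A = anyFin (λ y → A ==ˢ upSet R y)

  principals : Fam n
  principals = famOf isPrincipal

  principals-elim : ∀ {A} → A ∈ᶠ principals → ∃ λ y → A ≡ upSet R y
  principals-elim {A} p with anyFin-elim {p = λ y → A ==ˢ upSet R y} (trans (sym (memb-famOf isPrincipal A)) p)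
  ... | y , q = y , does-sound (A ≟ˢ _) q

  principals-intro : ∀ y → upSet R y ∈ᶠ principals
  principals-intro y = trans (memb-famOf isPrincipal (upSet R y))
    (anyFin-intro {p = λ y' → upSet R y ==ˢ upSet R y'} y (==ˢ-refl (upSet R y)))

  principals-covering : IsOpenCovering (upSets R) principals
  principals-covering = principals-open , λ x →
    upSet R x , principals-intro x , true⇒∈ (trans (lookup-upSet R x x) (rf x))
    where
    principals-open : ∀ A → A ∈ᶠ principals → A ∈ᶠ upSets R
    principals-open A A∈ with principals-elim A∈
    ... | y , refl = upSet-open R tr y

  -- Conversely, refine the covering by principal up-sets to order ≤ 0.  A
  -- member containing a minimal element m lies inside some ↑y, so inside ↑m;
  -- two minimal elements below x give two members meeting in x, hence equal.
  dim≤0⇒unique-minima : DimLe (upSets R) 1 → UniqueMinima R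
  dim≤0⇒unique-minima dim≤0 x m m' mm mm' rmx rm'x with dim≤0 principals principals-covering
  ... | ℬ , (ℬ-open , ℬ-covers) , finer , order≤0 = same-minimum
    where
    member-at : ∀ m → Minimal R m →
      ∃ λ B → B ∈ᶠ ℬ × lookup B m ≡ true × (∀ z → lookup B z ≡ true → R ⟨ m , z ⟩ ≡ true)
    member-at m mm with ℬ-covers m
    ... | B , B∈ℬ , m∈B with finer B B∈ℬ
    ...   | A , A∈ , B⊆A with principals-elim A∈
    ...     | y , A≡↑y = B , B∈ℬ , ∈⇒true m∈B , λ z z∈B →
                subst (λ a → R ⟨ a , z ⟩ ≡ true) (mm y (↑-elim A≡↑y (∈⇒true (B⊆A m∈B))))
                      (↑-elim A≡↑y (∈⇒true (B⊆A (true⇒∈ z∈B))))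
    same-minimum : m ≡ m'
    same-minimum with member-at m mm | member-at m' mm'
    ... | B , B∈ , m∈B , B⊆↑m | B' , B'∈ , m'∈B' , B'⊆↑m'
      with order≤0⇒disjoint ℬ order≤0 B B' x B∈ B'∈ (true⇒∈ (upSets-elim R (ℬ-open B B∈) m x m∈B rmx))
                                                     (true⇒∈ (upSets-elim R (ℬ-open B' B'∈) m' x m'∈B' rm'x))
    ...   | refl = an m m' (B⊆↑m m' m'∈B') (B'⊆↑m' m m∈B)

ZeroDimT₀↔UMinOrder : ∀ n → 1 ≤ n → ZeroDimT₀Topology n ↔ UMinOrder n
ZeroDimT₀↔UMinOrder (suc n) _ = mk↔ₛ′ to from to∘from from∘to
  where
  to : ZeroDimT₀Topology (suc n) → UMinOrder (suc n)
  to (mkZ 𝒯 t t₀ d) = mkUMin (specialization 𝒯) (spec-refl 𝒯) (spec-antisym 𝒯 t₀) (spec-trans 𝒯)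
    (dim≤0⇒unique-minima (specialization 𝒯) (spec-refl 𝒯) (spec-antisym 𝒯 t₀) (spec-trans 𝒯)
      (subst (λ 𝒮 → DimLe 𝒮 1) (sym (upSets-spec 𝒯 t)) (proj₁ d)))
  from : UMinOrder (suc n) → ZeroDimT₀Topology (suc n)
  from (mkUMin R rf an tr um) = mkZ (upSets R) (upSets-topology R) (upSets-T₀ R rf an tr)
    (unique-minima⇒dim≤0 R rf an tr um , nonempty⇒¬dim≤-1 (upSets R) (upSets-topology R) zero)
  to∘from : ∀ p → to (from p) ≡ p
  to∘from (mkUMin R rf an tr um) = UMinOrder-ext (rel-irr (spec-upSets R rf tr))
  from∘to : ∀ z → from (to z) ≡ z
  from∘to (mkZ 𝒯 t t₀ d) = ZeroDim-ext (fam-irr (upSets-spec 𝒯 t))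
    where
    ZeroDim-ext : ∀ {𝒮} .{t′ t₀′ d′} → 𝒮 ≡ 𝒯 → mkZ 𝒮 t′ t₀′ d′ ≡ mkZ 𝒯 t t₀ d
    ZeroDim-ext refl = refl

-- A decidable property that holds somewhere, even irrelevantly, has a
-- computable witness (found by exhaustive search).
search : ∀ {n} (p : Fin n → Bool) → .(∃ λ i → p i ≡ true) → ∃ λ i → p i ≡ true
search p ex = anyFin-elim {p = p} (bool-irr (anyFin-intro {p = p} (proj₁ ex) (proj₂ ex)))

When : Bool → Set → Set
When true X = X
When false X = ⊤

when : ∀ b {X : Set} → (b ≡ true → X) → When b X
when true f = f refl
when false f = tt

unwhen : ∀ b {X : Set} → When b X → b ≡ true → X
unwhen true x _ = x

When-ext : ∀ b {X : Set} (u v : When b X) → (∀ p → unwhen b u p ≡ unwhen b v p) → u ≡ v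
When-ext true u v f = f refl
When-ext false tt tt f = refl

unwhen-when : ∀ b {X : Set} (f : b ≡ true → X) p → unwhen b (when b f) p ≡ f p
unwhen-when true f refl = refl

-- Dependent functions on Subset n, stored as a binary trie so that two of them
-- are equal as soon as they agree pointwise (no function extensionality).

ΠSub : ∀ n → (Subset n → Set) → Set
ΠSub zero F = F []
ΠSub (suc n) F = ΠSub n (λ A → F (false ∷ A)) × ΠSub n (λ A → F (true ∷ A))

apply : ∀ {n} {F : Subset n → Set} → ΠSub n F → (A : Subset n) → F A
apply {zero} d [] = d
apply {suc n} (d₀ , d₁) (false ∷ A) = apply d₀ A
apply {suc n} (d₀ , d₁) (true ∷ A) = apply d₁ A

abstractΠ : ∀ {n} {F : Subset n → Set} → ((A : Subset n) → F A) → ΠSub n F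
abstractΠ {zero} f = f []
abstractΠ {suc n} f = abstractΠ (λ A → f (false ∷ A)) , abstractΠ (λ A → f (true ∷ A))

apply-abstractΠ : ∀ {n} {F : Subset n → Set} (f : (A : Subset n) → F A) A → apply {n} {F} (abstractΠ f) A ≡ f A
apply-abstractΠ {zero} f [] = refl
apply-abstractΠ {suc n} f (false ∷ A) = apply-abstractΠ (λ A → f (false ∷ A)) A
apply-abstractΠ {suc n} f (true ∷ A) = apply-abstractΠ (λ A → f (true ∷ A)) A

ΠSub-ext : ∀ {n} {F : Subset n → Set} {d d' : ΠSub n F} →
  (∀ A → apply {n} {F} d A ≡ apply {n} {F} d' A) → d ≡ d'
ΠSub-ext {zero} h = h []
ΠSub-ext {suc n} {F} {d₀ , d₁} {d₀' , d₁'} h =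
  cong₂ _,_ (ΠSub-ext {F = λ A → F (false ∷ A)} (λ A → h (false ∷ A)))
            (ΠSub-ext {F = λ A → F (true ∷ A)} (λ A → h (true ∷ A)))

record RootedOn {n : ℕ} (A : Subset n) : Set where
  constructor mkRooted
  field
    rrel        : Rel n
    .support    : ∀ x y → rrel ⟨ x , y ⟩ ≡ true → lookup A x ≡ true × lookup A y ≡ true
    .refl-on    : ∀ x → lookup A x ≡ true → rrel ⟨ x , x ⟩ ≡ true
    .antisym    : Antisym rrel
    .transitive : Trans rrel
    .root       : ∃ λ r → lookup A r ≡ true × LeastIn rrel A r

RootedOn-ext : ∀ {n} {A : Subset n} {a b : RootedOn A} → RootedOn.rrel a ≡ RootedOn.rrel b → a ≡ b
RootedOn-ext {a = mkRooted r _ _ _ _ _} {mkRooted .r _ _ _ _ _} refl = refl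

module _ {n : ℕ} {A : Subset n} where

  rooted-support : (ρ : RootedOn A) → ∀ x y → RootedOn.rrel ρ ⟨ x , y ⟩ ≡ true →
    lookup A x ≡ true × lookup A y ≡ true
  rooted-support (mkRooted _ s _ _ _ _) x y p = bool-irr (proj₁ (s x y p)) , bool-irr (proj₂ (s x y p))

  rooted-refl : (ρ : RootedOn A) → ∀ x → lookup A x ≡ true → RootedOn.rrel ρ ⟨ x , x ⟩ ≡ true
  rooted-refl (mkRooted _ _ rf _ _ _) x p = bool-irr (rf x p)

  rooted-antisym : (ρ : RootedOn A) → Antisym (RootedOn.rrel ρ)
  rooted-antisym (mkRooted _ _ _ an _ _) x y p q = fin-irr (an x y p q)

  rooted-trans : (ρ : RootedOn A) → Trans (RootedOn.rrel ρ)
  rooted-trans (mkRooted _ _ _ _ tr _) x y z p q = bool-irr (tr x y z p q)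

  isRoot : Rel n → Fin n → Bool
  isRoot R r = lookup A r ∧ allFin (λ y → lookup A y ⇒ᵇ R ⟨ r , y ⟩)

  rootOf : (ρ : RootedOn A) → ∃ λ r → isRoot (RootedOn.rrel ρ) r ≡ true
  rootOf (mkRooted R _ _ _ _ rt) =
    search (isRoot R)
      (proj₁ rt , ∧-intro (proj₁ (proj₂ rt)) (allFin-intro (λ y → ⇒ᵇ-intro (proj₂ (proj₂ rt) y))))

  root-in : (ρ : RootedOn A) → lookup A (proj₁ (rootOf ρ)) ≡ true
  root-in ρ = ∧-trueˡ (proj₂ (rootOf ρ))

  root-least : (ρ : RootedOn A) → LeastIn (RootedOn.rrel ρ) A (proj₁ (rootOf ρ))
  root-least ρ y ay = ⇒ᵇ-elim (allFin-elim (∧-trueʳ {lookup A (proj₁ (rootOf ρ))} (proj₂ (rootOf ρ))) y) ay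

nontrivial : ∀ {n} → Subset n → Bool
nontrivial A = 1 <ᵇ ∣ A ∣

member⇒size≥1 : ∀ {n} (A : Subset n) x → lookup A x ≡ true → ∃ λ k → ∣ A ∣ ≡ suc k
member⇒size≥1 (true ∷ A) zero p = ∣ A ∣ , refl
member⇒size≥1 (true ∷ A) (suc x) p = ∣ A ∣ , refl
member⇒size≥1 (false ∷ A) (suc x) p = member⇒size≥1 A x p

distinct-members⇒size≥2 : ∀ {n} (A : Subset n) x y → lookup A x ≡ true → lookup A y ≡ true → ¬ x ≡ y →
  ∃ λ k → ∣ A ∣ ≡ suc (suc k)
distinct-members⇒size≥2 A zero zero p q x≢y = ⊥-elim (x≢y refl)
distinct-members⇒size≥2 (true ∷ A) zero (suc y) p q _ = let (k , e) = member⇒size≥1 A y q in k , cong suc e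
distinct-members⇒size≥2 (true ∷ A) (suc x) _ p q _ = let (k , e) = member⇒size≥1 A x p in k , cong suc e
distinct-members⇒size≥2 (false ∷ A) (suc x) (suc y) p q x≢y =
  distinct-members⇒size≥2 A x y p q (λ e → x≢y (cong suc e))

trivial-unique : ∀ {n} (A : Subset n) {x y} → nontrivial A ≡ false →
  lookup A x ≡ true → lookup A y ≡ true → x ≡ y
trivial-unique A {x} {y} small ax ay with x ≟ y
... | yes x≡y = x≡y
... | no x≢y with distinct-members⇒size≥2 A x y ax ay x≢y
...   | k , e = ⊥-elim (true≢false {1 <ᵇ suc (suc k)} refl (subst (λ m → (1 <ᵇ m) ≡ false) e small))

bigBlock : ∀ {n} → Fam n → Subset n → Bool
bigBlock 𝒫 A = memb 𝒫 A ∧ nontrivial A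

BlockOrders : ∀ {n} → Fam n → Set
BlockOrders {n} 𝒫 = ΠSub n (λ A → When (bigBlock 𝒫 A) (RootedOn A))

blockOrder : ∀ {n} (𝒫 : Fam n) → BlockOrders 𝒫 → (A : Subset n) → When (bigBlock 𝒫 A) (RootedOn A)
blockOrder {n} 𝒫 d A = apply {n} {λ A → When (bigBlock 𝒫 A) (RootedOn A)} d A

PartitionWithOrders : ℕ → Set
PartitionWithOrders n = Σ (Partition n) (λ 𝒫 → BlockOrders (Partition.blocks 𝒫))

PartitionWithOrders-ext : ∀ {n} {𝒫 𝒫' : Partition n} {d : BlockOrders (Partition.blocks 𝒫)}
  {d' : BlockOrders (Partition.blocks 𝒫')} → (e : Partition.blocks 𝒫 ≡ Partition.blocks 𝒫') →
  (∀ A p p' → RootedOn.rrel (unwhen (bigBlock (Partition.blocks 𝒫) A) (blockOrder _ d A) p)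
            ≡ RootedOn.rrel (unwhen (bigBlock (Partition.blocks 𝒫') A) (blockOrder _ d' A) p')) →
  _≡_ {A = PartitionWithOrders n} (𝒫 , d) (𝒫' , d')
PartitionWithOrders-ext {𝒫 = mkPart B a b c} {mkPart .B _ _ _} {d} {d'} refl h =
  cong (mkPart B a b c ,_) (ΠSub-ext {F = λ A → When (bigBlock B A) (RootedOn A)}
    (λ A → When-ext (bigBlock B A) (blockOrder B d A) (blockOrder B d' A) (λ p → RootedOn-ext (h A p p))))

blockRel : ∀ {n} {A : Subset n} b → When b (RootedOn A) → Fin n → Fin n → Bool
blockRel true ρ x y = RootedOn.rrel ρ ⟨ x , y ⟩
blockRel false _ x y = true

blockRel-big : ∀ {n} {A : Subset n} b (ρ : When b (RootedOn A)) (p : b ≡ true) x y →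
  blockRel b ρ x y ≡ RootedOn.rrel (unwhen b ρ p) ⟨ x , y ⟩
blockRel-big true ρ p x y = refl

blockRel-small : ∀ {n} {A : Subset n} b (ρ : When b (RootedOn A)) → b ≡ false →
  ∀ x y → blockRel b ρ x y ≡ true
blockRel-small false ρ p x y = refl

module _ {n : ℕ} (𝒫 : Fam n) (d : BlockOrders 𝒫) where

  inBlock : Subset n → Fin n → Fin n → Bool
  inBlock A = blockRel (bigBlock 𝒫 A) (blockOrder 𝒫 d A)

  glueTest : Fin n → Fin n → Subset n → Bool
  glueTest x y A = memb 𝒫 A ∧ (lookup A x ∧ (lookup A y ∧ inBlock A x y))

  glue : Rel n
  glue = relOf (λ x y → anySub (glueTest x y))

restrict : ∀ {n} → Rel n → Subset n → Rel n
restrict R A = relOf (λ x y → R ⟨ x , y ⟩ ∧ (lookup A x ∧ lookup A y))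

restrict-elim : ∀ {n} (R : Rel n) A x y → restrict R A ⟨ x , y ⟩ ≡ true →
  R ⟨ x , y ⟩ ≡ true × lookup A x ≡ true × lookup A y ≡ true
restrict-elim R A x y p = ∧-elim₃ {R ⟨ x , y ⟩} (trans (sym (relOf-⟨⟩ _ x y)) p)

restrict-intro : ∀ {n} (R : Rel n) A x y → R ⟨ x , y ⟩ ≡ true → lookup A x ≡ true → lookup A y ≡ true →
  restrict R A ⟨ x , y ⟩ ≡ true
restrict-intro R A x y r ax ay = trans (relOf-⟨⟩ _ x y) (∧-intro r (∧-intro ax ay))

module Glue {n : ℕ} (𝒫 : Fam n) (d : BlockOrders 𝒫)
  (nonempty : ∀ A → A ∈ᶠ 𝒫 → ∃ λ (x : Fin n) → x ∈ A)
  (disjoint : Disjoint 𝒫)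
  (cover    : ∀ (x : Fin n) → ∃ λ A → A ∈ᶠ 𝒫 × x ∈ A) where

  R : Rel n
  R = glue 𝒫 d

  glue-elim : ∀ x y → R ⟨ x , y ⟩ ≡ true → ∃ λ A →
    A ∈ᶠ 𝒫 × lookup A x ≡ true × lookup A y ≡ true × inBlock 𝒫 d A x y ≡ true
  glue-elim x y p with anySub-elim {p = glueTest 𝒫 d x y} (trans (sym (relOf-⟨⟩ _ x y)) p)
  ... | A , q with ∧-elim₃ {memb 𝒫 A} q
  ...   | A∈ , ax , q′ = A , A∈ , ax , ∧-trueˡ q′ , ∧-trueʳ {lookup A y} q′

  glue-intro : ∀ A x y → A ∈ᶠ 𝒫 → lookup A x ≡ true → lookup A y ≡ true → inBlock 𝒫 d A x y ≡ true →
    R ⟨ x , y ⟩ ≡ true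
  glue-intro A x y A∈ ax ay g = trans (relOf-⟨⟩ _ x y)
    (anySub-intro {p = glueTest 𝒫 d x y} A (∧-intro A∈ (∧-intro ax (∧-intro ay g))))

  same-block : ∀ A C x → A ∈ᶠ 𝒫 → C ∈ᶠ 𝒫 → lookup A x ≡ true → lookup C x ≡ true → A ≡ C
  same-block A C x A∈ C∈ ax cx = disjoint A C x A∈ C∈ (true⇒∈ ax) (true⇒∈ cx)

  glue-in-block : ∀ A x y → A ∈ᶠ 𝒫 → lookup A x ≡ true → R ⟨ x , y ⟩ ≡ true →
    lookup A y ≡ true × inBlock 𝒫 d A x y ≡ true
  glue-in-block A x y A∈ ax p with glue-elim x y p
  ... | C , C∈ , cx , cy , g with same-block C A x C∈ A∈ cx ax
  ...   | refl = cy , g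

  block-of : ∀ x → ∃ λ A → A ∈ᶠ 𝒫 × lookup A x ≡ true
  block-of x with cover x
  ... | A , A∈ , x∈A = A , A∈ , ∈⇒true x∈A

  small-block : ∀ {A} → A ∈ᶠ 𝒫 → bigBlock 𝒫 A ≡ false → nontrivial A ≡ false
  small-block {A} A∈ e = trans (sym (cong (_∧ nontrivial A) A∈)) e

  orderOf : ∀ A → bigBlock 𝒫 A ≡ true → RootedOn A
  orderOf A e = unwhen (bigBlock 𝒫 A) (blockOrder 𝒫 d A) e

  inBlock-big : ∀ A e x y → inBlock 𝒫 d A x y ≡ RootedOn.rrel (orderOf A e) ⟨ x , y ⟩
  inBlock-big A = blockRel-big (bigBlock 𝒫 A) (blockOrder 𝒫 d A)

  inBlock-small : ∀ A → bigBlock 𝒫 A ≡ false → ∀ x y → inBlock 𝒫 d A x y ≡ true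
  inBlock-small A = blockRel-small (bigBlock 𝒫 A) (blockOrder 𝒫 d A)

  glue-refl : Refl R
  glue-refl x with block-of x
  ... | A , A∈ , ax = glue-intro A x x A∈ ax ax g
    where
    g : inBlock 𝒫 d A x x ≡ true
    g with bool-case (bigBlock 𝒫 A)
    ... | inj₁ e = trans (inBlock-big A e x x) (rooted-refl (orderOf A e) x ax)
    ... | inj₂ e = inBlock-small A e x x

  glue-trans : Trans R
  glue-trans x y z p q with glue-elim x y p
  ... | A , A∈ , ax , ay , g₁ with glue-in-block A y z A∈ ay q
  ...   | az , g₂ = glue-intro A x z A∈ ax az g
    where
    g : inBlock 𝒫 d A x z ≡ true
    g with bool-case (bigBlock 𝒫 A)
    ... | inj₁ e = trans (inBlock-big A e x z) (rooted-trans (orderOf A e) x y z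
                     (trans (sym (inBlock-big A e x y)) g₁) (trans (sym (inBlock-big A e y z)) g₂))
    ... | inj₂ e = inBlock-small A e x z

  glue-antisym : Antisym R
  glue-antisym x y p q with glue-elim x y p
  ... | A , A∈ , ax , ay , g₁ with glue-in-block A y x A∈ ay q
  ...   | _ , g₂ with bool-case (bigBlock 𝒫 A)
  ...     | inj₁ e = rooted-antisym (orderOf A e) x y
                       (trans (sym (inBlock-big A e x y)) g₁) (trans (sym (inBlock-big A e y x)) g₂)
  ...     | inj₂ e = trivial-unique A (small-block A∈ e) ax ay

  block-root : ∀ A x → A ∈ᶠ 𝒫 → lookup A x ≡ true →
    ∃ λ r → lookup A r ≡ true × LeastIn R A r
  block-root A x A∈ ax with bool-case (bigBlock 𝒫 A)
  ... | inj₁ e = r , root-in ρ , λ y ay →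
        glue-intro A r y A∈ (root-in ρ) ay (trans (inBlock-big A e r y) (root-least ρ y ay))
    where
    ρ = orderOf A e
    r = proj₁ (rootOf ρ)
  ... | inj₂ e = x , ax , λ y ay →
        subst (λ w → R ⟨ x , w ⟩ ≡ true) (trivial-unique A (small-block A∈ e) ax ay) (glue-refl x)

  root⇒minimal : ∀ A r → A ∈ᶠ 𝒫 → lookup A r ≡ true → LeastIn R A r →
    Minimal R r
  root⇒minimal A r A∈ ar least y p with glue-elim y r p
  ... | C , C∈ , cy , cr , _ with same-block C A r C∈ A∈ cr ar
  ...   | refl = glue-antisym y r p (least y cy)

  root⇒upSet : ∀ A r → A ∈ᶠ 𝒫 → lookup A r ≡ true → LeastIn R A r →
    upSet R r ≡ A
  root⇒upSet A r A∈ ar least = vec-ext (λ z →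
    trans (lookup-upSet R r z) (bool-ext (λ p → proj₁ (glue-in-block A r z A∈ ar p)) (least z)))

  glue-unique-minima : UniqueMinima R
  glue-unique-minima x m m' mm mm' p p' with glue-elim m x p | glue-elim m' x p'
  ... | A , A∈ , am , ax , _ | C , C∈ , cm' , cx , _ with same-block C A x C∈ A∈ cx ax
  ...   | refl with block-root A m A∈ am
  ...     | r , ar , least = trans (sym (mm r (least m am))) (mm' r (least m' cm'))

  components-glue : ∀ A → memb (components R) A ≡ memb 𝒫 A
  components-glue A = bool-ext component⇒block block⇒component
    where
    component⇒block : A ∈ᶠ components R → A ∈ᶠ 𝒫
    component⇒block p with components-elim R p
    ... | m , mm , A≡↑m with block-of m
    ...   | C , C∈ , cm with block-root C m C∈ cm
    ...     | r , cr , least with mm r (least m cm)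
    ...       | refl = subst (_∈ᶠ 𝒫) (sym (trans A≡↑m (root⇒upSet C r C∈ cr least))) C∈
    block⇒component : A ∈ᶠ 𝒫 → A ∈ᶠ components R
    block⇒component A∈ with nonempty A A∈
    ... | x , x∈A with block-root A x A∈ (∈⇒true x∈A)
    ...   | r , ar , least =
            subst (_∈ᶠ components R) (root⇒upSet A r A∈ ar least)
                  (components-intro R (root⇒minimal A r A∈ ar least))

  restrict-glue : ∀ A (e : bigBlock 𝒫 A ≡ true) → restrict R A ≡ RootedOn.rrel (orderOf A e)
  restrict-glue A e = rel-ext (λ x y → bool-ext (⇒ x y) (⇐ x y))
    where
    ρ = orderOf A e
    ⇒ : ∀ x y → restrict R A ⟨ x , y ⟩ ≡ true → RootedOn.rrel ρ ⟨ x , y ⟩ ≡ true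
    ⇒ x y q with restrict-elim R A x y q
    ... | rxy , ax , _ = trans (sym (inBlock-big A e x y)) (proj₂ (glue-in-block A x y (∧-trueˡ e) ax rxy))
    ⇐ : ∀ x y → RootedOn.rrel ρ ⟨ x , y ⟩ ≡ true → restrict R A ⟨ x , y ⟩ ≡ true
    ⇐ x y q with rooted-support ρ x y q
    ... | ax , ay = restrict-intro R A x y (glue-intro A x y (∧-trueˡ e) ax ay (trans (inBlock-big A e x y) q)) ax ay

module Restrict {n : ℕ} (R : Rel n) (rf : Refl R) (an : Antisym R) (tr : Trans R) where

  restrict-support : ∀ A x y → restrict R A ⟨ x , y ⟩ ≡ true → lookup A x ≡ true × lookup A y ≡ true
  restrict-support A x y p = proj₂ (restrict-elim R A x y p)

  restrict-refl : ∀ A x → lookup A x ≡ true → restrict R A ⟨ x , x ⟩ ≡ true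
  restrict-refl A x ax = restrict-intro R A x x (rf x) ax ax

  restrict-antisym : ∀ A → Antisym (restrict R A)
  restrict-antisym A x y p q = an x y (proj₁ (restrict-elim R A x y p)) (proj₁ (restrict-elim R A y x q))

  restrict-trans : ∀ A → Trans (restrict R A)
  restrict-trans A x y z p q with restrict-elim R A x y p | restrict-elim R A y z q
  ... | rxy , ax , _ | ryz , _ , az = restrict-intro R A x z (tr x y z rxy ryz) ax az

  component-root : ∀ A → A ∈ᶠ components R →
    ∃ λ r → lookup A r ≡ true × LeastIn (restrict R A) A r
  component-root A A∈ with components-elim R A∈
  ... | m , _ , refl = m , m∈↑m R rf an tr m , λ y ay →
        restrict-intro R (upSet R m) m y (trans (sym (lookup-upSet R m y)) ay) (m∈↑m R rf an tr m) ay

restrictRooted : ∀ {n} (R : Rel n) → .(Refl R) → .(Antisym R) → .(Trans R) →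
  (A : Subset n) → bigBlock (components R) A ≡ true → RootedOn A
restrictRooted R rf an tr A e = mkRooted (restrict R A)
  (Restrict.restrict-support R rf an tr A) (Restrict.restrict-refl R rf an tr A)
  (Restrict.restrict-antisym R rf an tr A) (Restrict.restrict-trans R rf an tr A)
  (Restrict.component-root R rf an tr A (∧-trueˡ e))

splitOrders : ∀ {n} (R : Rel n) → .(Refl R) → .(Antisym R) → .(Trans R) → BlockOrders (components R)
splitOrders {n} R rf an tr = abstractΠ {n} {λ A → When (bigBlock (components R) A) (RootedOn A)}
  (λ A → when (bigBlock (components R) A) (restrictRooted R rf an tr A))

componentPartition : ∀ {n} (R : Rel n) → .(Refl R) → .(Antisym R) → .(Trans R) → .(UniqueMinima R) → Partition n
componentPartition R rf an tr um =
  mkPart (components R) (components-nonempty R rf an tr) (components-disjoint R rf an tr um)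
    (components-cover R rf an tr)

splitOrders-rel : ∀ {n} (R : Rel n) .(rf : Refl R) .(an : Antisym R) .(tr : Trans R) A e →
  RootedOn.rrel (unwhen (bigBlock (components R) A) (blockOrder (components R) (splitOrders R rf an tr) A) e)
    ≡ restrict R A
splitOrders-rel {n} R rf an tr A e = cong RootedOn.rrel (begin
    unwhen b (blockOrder (components R) (splitOrders R rf an tr) A) e
  ≡⟨ cong (λ t → unwhen b t e)
          (apply-abstractΠ {n} {λ A → When (bigBlock (components R) A) (RootedOn A)} (λ A → when _ (ρ A)) A) ⟩
    unwhen b (when b (ρ A)) e
  ≡⟨ unwhen-when b (ρ A) e ⟩
    ρ A e
  ∎)
  where
  open ≡-Reasoning
  b = bigBlock (components R) A
  ρ = restrictRooted R rf an tr

glue-split : ∀ {n} (R : Rel n) (rf : Refl R) (an : Antisym R) (tr : Trans R) (um : UniqueMinima R) →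
  glue (components R) (splitOrders R rf an tr) ≡ R
glue-split R rf an tr um = rel-ext (λ x y → bool-ext (⇒ x y) (⇐ x y))
  where
  module G = Glue (components R) (splitOrders R rf an tr)
               (components-nonempty R rf an tr) (components-disjoint R rf an tr um) (components-cover R rf an tr)
  ⇒ : ∀ x y → G.R ⟨ x , y ⟩ ≡ true → R ⟨ x , y ⟩ ≡ true
  ⇒ x y p with G.glue-elim x y p
  ... | A , A∈ , ax , ay , g with bool-case (bigBlock (components R) A)
  ...   | inj₁ e = proj₁ (restrict-elim R A x y
                     (subst (λ Q → Q ⟨ x , y ⟩ ≡ true) (splitOrders-rel R rf an tr A e)
                            (trans (sym (G.inBlock-big A e x y)) g)))
  ...   | inj₂ e = subst (λ w → R ⟨ x , w ⟩ ≡ true) (trivial-unique A (G.small-block A∈ e) ax ay) (rf x)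
  ⇐ : ∀ x y → R ⟨ x , y ⟩ ≡ true → G.R ⟨ x , y ⟩ ≡ true
  ⇐ x y r with G.block-of x
  ... | A , A∈ , ax with components-elim R A∈
  ...   | m , mm , refl = G.glue-intro A x y A∈ ax ay g
    where
    ay : lookup A y ≡ true
    ay = trans (lookup-upSet R m y) (tr m x y (trans (sym (lookup-upSet R m x)) ax) r)
    g : inBlock (components R) (splitOrders R rf an tr) A x y ≡ true
    g with bool-case (bigBlock (components R) A)
    ... | inj₁ e = trans (G.inBlock-big A e x y)
                     (subst (λ Q → Q ⟨ x , y ⟩ ≡ true) (sym (splitOrders-rel R rf an tr A e))
                            (restrict-intro R A x y r ax ay))
    ... | inj₂ e = G.inBlock-small A e x y

UMinOrder↔PartitionWithOrders : ∀ n → UMinOrder n ↔ PartitionWithOrders n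
UMinOrder↔PartitionWithOrders n = mk↔ₛ′ split glueBack split∘glue glue∘split
  where
  split : UMinOrder n → PartitionWithOrders n
  split (mkUMin R rf an tr um) = componentPartition R rf an tr um , splitOrders R rf an tr
  glueBack : PartitionWithOrders n → UMinOrder n
  glueBack (mkPart 𝒫 ne dj cv , d) = mkUMin (glue 𝒫 d)
    (Glue.glue-refl 𝒫 d ne dj cv) (Glue.glue-antisym 𝒫 d ne dj cv)
    (Glue.glue-trans 𝒫 d ne dj cv) (Glue.glue-unique-minima 𝒫 d ne dj cv)
  split∘glue : ∀ s → split (glueBack s) ≡ s
  split∘glue (mkPart 𝒫 ne dj cv , d) =
    PartitionWithOrders-ext (fam-irr (fam-ext (Glue.components-glue 𝒫 d ne dj cv))) (λ A p p' →
      trans (splitOrders-rel (glue 𝒫 d) (Glue.glue-refl 𝒫 d ne dj cv) (Glue.glue-antisym 𝒫 d ne dj cv)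
                             (Glue.glue-trans 𝒫 d ne dj cv) A p)
            (rel-irr (Glue.restrict-glue 𝒫 d ne dj cv A p')))
  glue∘split : ∀ p → glueBack (split p) ≡ p
  glue∘split (mkUMin R rf an tr um) = UMinOrder-ext (rel-irr (glue-split R rf an tr um))

module _ {k n : ℕ} (e : Fin k → Fin n) where

  pullback : Rel n → Rel k
  pullback R = relOf (λ i j → R ⟨ e i , e j ⟩)

  pushTest : Rel k → Fin n → Fin n → Bool
  pushTest Q x y = anyFin (λ i → anyFin (λ j → (e i == x) ∧ ((e j == y) ∧ Q ⟨ i , j ⟩)))

  pushforward : Rel k → Rel n
  pushforward Q = relOf (pushTest Q)

  pullback-⟨⟩ : ∀ R i j → pullback R ⟨ i , j ⟩ ≡ R ⟨ e i , e j ⟩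
  pullback-⟨⟩ R = relOf-⟨⟩ (λ i j → R ⟨ e i , e j ⟩)

  pushforward-elim : ∀ Q x y → pushforward Q ⟨ x , y ⟩ ≡ true →
    ∃ λ i → ∃ λ j → e i ≡ x × e j ≡ y × Q ⟨ i , j ⟩ ≡ true
  pushforward-elim Q x y p
    with anyFin-elim {p = λ i → anyFin (λ j → (e i == x) ∧ ((e j == y) ∧ Q ⟨ i , j ⟩))}
                     (trans (sym (relOf-⟨⟩ (pushTest Q) x y)) p)
  ... | i , q with anyFin-elim {p = λ j → (e i == x) ∧ ((e j == y) ∧ Q ⟨ i , j ⟩)} q
  ...   | j , r with ∧-elim₃ {e i == x} r
  ...     | ix , jy , qij = i , j , does-sound (e i ≟ x) ix , does-sound (e j ≟ y) jy , qij

  pushforward-intro : ∀ Q i j → Q ⟨ i , j ⟩ ≡ true → pushforward Q ⟨ e i , e j ⟩ ≡ true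
  pushforward-intro Q i j q = trans (relOf-⟨⟩ (pushTest Q) (e i) (e j))
    (anyFin-intro {p = λ i' → anyFin (λ j' → (e i' == e i) ∧ ((e j' == e j) ∧ Q ⟨ i' , j' ⟩))} i
      (anyFin-intro {p = λ j' → (e i == e i) ∧ ((e j' == e j) ∧ Q ⟨ i , j' ⟩)} j
        (∧-intro (==-refl (e i)) (∧-intro (==-refl (e j)) q))))

  module _ (inj : ∀ {i j} → e i ≡ e j → i ≡ j) where

    pushforward-⟨⟩ : ∀ Q i j → pushforward Q ⟨ e i , e j ⟩ ≡ Q ⟨ i , j ⟩
    pushforward-⟨⟩ Q i j = bool-ext back (pushforward-intro Q i j)
      where
      back : pushforward Q ⟨ e i , e j ⟩ ≡ true → Q ⟨ i , j ⟩ ≡ true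
      back p with pushforward-elim Q (e i) (e j) p
      ... | i' , j' , ei , ej , q with inj ei | inj ej
      ...   | refl | refl = q

    pullback-pushforward : ∀ Q → pullback (pushforward Q) ≡ Q
    pullback-pushforward Q = rel-ext (λ i j → trans (pullback-⟨⟩ (pushforward Q) i j) (pushforward-⟨⟩ Q i j))

  pushforward-pullback : ∀ R → (∀ x y → R ⟨ x , y ⟩ ≡ true → (∃ λ i → e i ≡ x) × (∃ λ j → e j ≡ y)) →
    pushforward (pullback R) ≡ R
  pushforward-pullback R supported = rel-ext (λ x y → bool-ext (⇒ x y) (⇐ x y))
    where
    ⇒ : ∀ x y → pushforward (pullback R) ⟨ x , y ⟩ ≡ true → R ⟨ x , y ⟩ ≡ true
    ⇒ x y p with pushforward-elim (pullback R) x y p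
    ... | i , j , refl , refl , q = trans (sym (pullback-⟨⟩ R i j)) q
    ⇐ : ∀ x y → R ⟨ x , y ⟩ ≡ true → pushforward (pullback R) ⟨ x , y ⟩ ≡ true
    ⇐ x y r with supported x y r
    ... | (i , refl) , (j , refl) = pushforward-intro (pullback R) i j (trans (pullback-⟨⟩ R i j) r)

record RootedOrder (k : ℕ) : Set where
  constructor mkRootedOrder
  field
    rel      : Rel k
    .reflexive  : Refl rel
    .antisym    : Antisym rel
    .transitive : Trans rel
    .root       : ∃ λ r → ∀ y → rel ⟨ r , y ⟩ ≡ true

RootedOrder-ext : ∀ {k} {a b : RootedOrder k} → RootedOrder.rel a ≡ RootedOrder.rel b → a ≡ b
RootedOrder-ext {a = mkRootedOrder r _ _ _ _} {mkRootedOrder .r _ _ _ _} refl = refl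

PartialOrder-ext : ∀ {k} {a b : PartialOrder k} → PartialOrder.rel a ≡ PartialOrder.rel b → a ≡ b
PartialOrder-ext {a = mkPO r _ _ _} {mkPO .r _ _ _} refl = refl

enum : ∀ {n} (A : Subset n) → Fin ∣ A ∣ → Fin n
enum (true ∷ A) zero = zero
enum (true ∷ A) (suc i) = suc (enum A i)
enum (false ∷ A) i = suc (enum A i)

enum-∈ : ∀ {n} (A : Subset n) i → lookup A (enum A i) ≡ true
enum-∈ (true ∷ A) zero = refl
enum-∈ (true ∷ A) (suc i) = enum-∈ A i
enum-∈ (false ∷ A) i = enum-∈ A i

enum-injective : ∀ {n} (A : Subset n) {i j} → enum A i ≡ enum A j → i ≡ j
enum-injective (true ∷ A) {zero} {zero} e = refl
enum-injective (true ∷ A) {suc i} {suc j} e = cong suc (enum-injective A (suc-injective e))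
enum-injective (false ∷ A) e = enum-injective A (suc-injective e)

enum-onto : ∀ {n} (A : Subset n) x → lookup A x ≡ true → ∃ λ i → enum A i ≡ x
enum-onto (true ∷ A) zero p = zero , refl
enum-onto (true ∷ A) (suc x) p = let (i , e) = enum-onto A x p in suc i , cong suc e
enum-onto (false ∷ A) (suc x) p = let (i , e) = enum-onto A x p in i , cong suc e

RootedOn↔RootedOrder : ∀ {n} (A : Subset n) → RootedOn A ↔ RootedOrder ∣ A ∣
RootedOn↔RootedOrder {n} A = mk↔ₛ′ to from to∘from from∘to
  where
  e = enum A
  inj : ∀ {i j} → e i ≡ e j → i ≡ j
  inj = enum-injective A
  pb : ∀ R i j → pullback e R ⟨ i , j ⟩ ≡ R ⟨ e i , e j ⟩
  pb = pullback-⟨⟩ e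
  pf : ∀ Q i j → pushforward e Q ⟨ e i , e j ⟩ ≡ Q ⟨ i , j ⟩
  pf = pushforward-⟨⟩ e inj

  pullback-refl : ∀ R → (∀ x → lookup A x ≡ true → R ⟨ x , x ⟩ ≡ true) → Refl (pullback e R)
  pullback-refl R rf i = trans (pb R i i) (rf (e i) (enum-∈ A i))
  pullback-antisym : ∀ R → Antisym R → Antisym (pullback e R)
  pullback-antisym R an i j p q = inj (an (e i) (e j) (trans (sym (pb R i j)) p) (trans (sym (pb R j i)) q))
  pullback-trans : ∀ R → Trans R → Trans (pullback e R)
  pullback-trans R tr i j l p q =
    trans (pb R i l) (tr (e i) (e j) (e l) (trans (sym (pb R i j)) p) (trans (sym (pb R j l)) q))
  pullback-root : ∀ R → (∃ λ r → lookup A r ≡ true × LeastIn R A r) →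
    ∃ λ r → ∀ y → pullback e R ⟨ r , y ⟩ ≡ true
  pullback-root R (r , ar , least) with enum-onto A r ar
  ... | i , refl = i , λ j → trans (pb R i j) (least (e j) (enum-∈ A j))
  to : RootedOn A → RootedOrder ∣ A ∣
  to (mkRooted R _ rf an tr rt) =
    mkRootedOrder (pullback e R) (pullback-refl R rf) (pullback-antisym R an) (pullback-trans R tr) (pullback-root R rt)

  pushforward-support : ∀ Q x y → pushforward e Q ⟨ x , y ⟩ ≡ true → lookup A x ≡ true × lookup A y ≡ true
  pushforward-support Q x y p with pushforward-elim e Q x y p
  ... | i , j , refl , refl , _ = enum-∈ A i , enum-∈ A j
  pushforward-refl : ∀ Q → Refl Q → ∀ x → lookup A x ≡ true → pushforward e Q ⟨ x , x ⟩ ≡ true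
  pushforward-refl Q rf x ax with enum-onto A x ax
  ... | i , refl = pushforward-intro e Q i i (rf i)
  pushforward-antisym : ∀ Q → Antisym Q → Antisym (pushforward e Q)
  pushforward-antisym Q an x y p q with pushforward-elim e Q x y p
  ... | i , j , refl , refl , qij = cong e (an i j qij (trans (sym (pf Q j i)) q))
  pushforward-trans : ∀ Q → Trans Q → Trans (pushforward e Q)
  pushforward-trans Q tr x y z p q with pushforward-elim e Q x y p | pushforward-elim e Q y z q
  ... | i , j , refl , refl , qij | j' , l , ej , refl , qjl with inj ej
  ...   | refl = pushforward-intro e Q i l (tr i j l qij qjl)
  pushforward-root : ∀ Q → (∃ λ r → ∀ y → Q ⟨ r , y ⟩ ≡ true) →
    ∃ λ r → lookup A r ≡ true × LeastIn (pushforward e Q) A r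
  pushforward-root Q (i , least) = e i , enum-∈ A i , above
    where
    above : LeastIn (pushforward e Q) A (e i)
    above y ay with enum-onto A y ay
    ... | j , refl = pushforward-intro e Q i j (least j)
  from : RootedOrder ∣ A ∣ → RootedOn A
  from (mkRootedOrder Q rf an tr rt) = mkRooted (pushforward e Q) (pushforward-support Q) (pushforward-refl Q rf)
    (pushforward-antisym Q an) (pushforward-trans Q tr) (pushforward-root Q rt)

  to∘from : ∀ p → to (from p) ≡ p
  to∘from (mkRootedOrder Q _ _ _ _) = RootedOrder-ext (pullback-pushforward e inj Q)
  from∘to : ∀ r → from (to r) ≡ r
  from∘to (mkRooted R s _ _ _ _) = RootedOn-ext (pushforward-pullback e R (λ x y p →
    enum-onto A x (bool-irr (proj₁ (s x y p))) , enum-onto A y (bool-irr (proj₂ (s x y p)))))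

-- A rooted order on Fin (suc k) is its root r together with an arbitrary
-- partial order on the remaining k points, identified with Fin k by punchIn r.

module _ {k : ℕ} where

  addRootTest : Fin (suc k) → Rel k → Fin (suc k) → Fin (suc k) → Bool
  addRootTest r Q x y = (x == r) ∨ pushforward (punchIn r) Q ⟨ x , y ⟩

  addRoot : Fin (suc k) → Rel k → Rel (suc k)
  addRoot r Q = relOf (addRootTest r Q)

  private
    ↑ᵣ : Fin (suc k) → Rel k → Rel (suc k)
    ↑ᵣ r = pushforward (punchIn r)

  ↑ᵣ-avoids-rootʳ : ∀ r Q x → ↑ᵣ r Q ⟨ x , r ⟩ ≡ false
  ↑ᵣ-avoids-rootʳ r Q x = ¬true⇒false (λ p → let (_ , j , _ , jr , _) = pushforward-elim (punchIn r) Q x r p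
                                               in punchInᵢ≢i r j jr)

  punchIn-onto : ∀ r (x : Fin (suc k)) → ¬ x ≡ r → ∃ λ i → punchIn r i ≡ x
  punchIn-onto r x x≢r = punchOut (λ e → x≢r (sym e)) , punchIn-punchOut (λ e → x≢r (sym e))

  addRoot-nonroot : ∀ r Q x y → ¬ x ≡ r → addRoot r Q ⟨ x , y ⟩ ≡ ↑ᵣ r Q ⟨ x , y ⟩
  addRoot-nonroot r Q x y x≢r =
    trans (relOf-⟨⟩ (addRootTest r Q) x y) (cong (_∨ ↑ᵣ r Q ⟨ x , y ⟩) (dec-false (x ≟ r) x≢r))

  addRoot-punchIn : ∀ r Q i j → addRoot r Q ⟨ punchIn r i , punchIn r j ⟩ ≡ Q ⟨ i , j ⟩
  addRoot-punchIn r Q i j = trans (addRoot-nonroot r Q _ _ (punchInᵢ≢i r i))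
                                  (pushforward-⟨⟩ (punchIn r) (punchIn-injective r _ _) Q i j)

  addRoot-root : ∀ r Q y → addRoot r Q ⟨ r , y ⟩ ≡ true
  addRoot-root r Q y = trans (relOf-⟨⟩ (addRootTest r Q) r y) (cong (_∨ ↑ᵣ r Q ⟨ r , y ⟩) (==-refl r))

  addRoot-below-root : ∀ r Q x → ¬ x ≡ r → addRoot r Q ⟨ x , r ⟩ ≡ false
  addRoot-below-root r Q x x≢r = trans (addRoot-nonroot r Q x r x≢r) (↑ᵣ-avoids-rootʳ r Q x)

  data RootOrImage (r : Fin (suc k)) : Fin (suc k) → Set where
    the-root  : RootOrImage r r
    image : ∀ i → RootOrImage r (punchIn r i)

  root-or-image : ∀ r x → RootOrImage r x
  root-or-image r x with x ≟ r
  ... | yes refl = the-root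
  ... | no x≢r with punchIn-onto r x x≢r
  ...   | i , refl = image i

  addRoot-refl : ∀ r Q → Refl Q → Refl (addRoot r Q)
  addRoot-refl r Q rf x with root-or-image r x
  ... | the-root = addRoot-root r Q r
  ... | image i = trans (addRoot-punchIn r Q i i) (rf i)

  addRoot-antisym : ∀ r Q → Antisym Q → Antisym (addRoot r Q)
  addRoot-antisym r Q an x y p q with root-or-image r x | root-or-image r y
  ... | the-root | the-root = refl
  ... | the-root | image j = ⊥-elim (true≢false q (addRoot-below-root r Q _ (punchInᵢ≢i r j)))
  ... | image i | the-root = ⊥-elim (true≢false p (addRoot-below-root r Q _ (punchInᵢ≢i r i)))
  ... | image i | image j =
    cong (punchIn r) (an i j (trans (sym (addRoot-punchIn r Q i j)) p) (trans (sym (addRoot-punchIn r Q j i)) q))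

  addRoot-trans : ∀ r Q → Trans Q → Trans (addRoot r Q)
  addRoot-trans r Q tr x y z p q with root-or-image r x | root-or-image r y | root-or-image r z
  ... | the-root | _ | _ = addRoot-root r Q z
  ... | image i | the-root | _ = ⊥-elim (true≢false p (addRoot-below-root r Q _ (punchInᵢ≢i r i)))
  ... | image _ | image j | the-root = ⊥-elim (true≢false q (addRoot-below-root r Q _ (punchInᵢ≢i r j)))
  ... | image i | image j | image l = trans (addRoot-punchIn r Q i l)
    (tr i j l (trans (sym (addRoot-punchIn r Q i j)) p) (trans (sym (addRoot-punchIn r Q j l)) q))

  findRoot : (R : Rel (suc k)) → .(∃ λ r → ∀ y → R ⟨ r , y ⟩ ≡ true) → ∃ λ r → ∀ y → R ⟨ r , y ⟩ ≡ true
  findRoot R rt = proj₁ found , allFin-elim (proj₂ found)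
    where found = search (λ r → allFin (λ y → R ⟨ r , y ⟩)) (proj₁ rt , allFin-intro (proj₂ rt))

  removeRoot : Fin (suc k) → Rel (suc k) → Rel k
  removeRoot r = pullback (punchIn r)

  removeRoot-addRoot : ∀ r Q → removeRoot r (addRoot r Q) ≡ Q
  removeRoot-addRoot r Q =
    rel-ext (λ i j → trans (pullback-⟨⟩ (punchIn r) (addRoot r Q) i j) (addRoot-punchIn r Q i j))

  addRoot-removeRoot : ∀ r R → Antisym R → (∀ y → R ⟨ r , y ⟩ ≡ true) → addRoot r (removeRoot r R) ≡ R
  addRoot-removeRoot r R an least = rel-ext agree
    where
    agree : ∀ x y → addRoot r (removeRoot r R) ⟨ x , y ⟩ ≡ R ⟨ x , y ⟩
    Q = removeRoot r R
    agree x y with root-or-image r x | root-or-image r y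
    ... | the-root | _ = trans (addRoot-root r Q y) (sym (least y))
    ... | image i | the-root = trans (addRoot-below-root r Q _ (punchInᵢ≢i r i))
                                     (sym (¬true⇒false (λ q → punchInᵢ≢i r i (an _ r q (least _)))))
    ... | image i | image j = trans (addRoot-punchIn r Q i j) (pullback-⟨⟩ (punchIn r) R i j)

  root-unique : ∀ r Q r' → (∀ y → addRoot r Q ⟨ r' , y ⟩ ≡ true) → r' ≡ r
  root-unique r Q r' least with r' ≟ r
  ... | yes e = e
  ... | no r'≢r = ⊥-elim (true≢false (least r) (addRoot-below-root r Q r' r'≢r))

RootedOrder↔Root×PartialOrder : ∀ k → RootedOrder (suc k) ↔ (Fin (suc k) × PartialOrder k)
RootedOrder↔Root×PartialOrder k = mk↔ₛ′ to from to∘from from∘to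
  where
  to : RootedOrder (suc k) → Fin (suc k) × PartialOrder k
  to (mkRootedOrder R rf an tr rt) = r , mkPO (removeRoot r R)
      (λ i → trans (pb i i) (rf _))
      (λ i j p q → punchIn-injective r _ _ (an _ _ (trans (sym (pb i j)) p) (trans (sym (pb j i)) q)))
      (λ i j l p q → trans (pb i l) (tr _ _ _ (trans (sym (pb i j)) p) (trans (sym (pb j l)) q)))
    where
    r = proj₁ (findRoot R rt)
    pb = pullback-⟨⟩ (punchIn r) R
  from : Fin (suc k) × PartialOrder k → RootedOrder (suc k)
  from (r , mkPO Q rf an tr) =
    mkRootedOrder (addRoot r Q) (addRoot-refl r Q rf) (addRoot-antisym r Q an) (addRoot-trans r Q tr) (r , addRoot-root r Q)
  to∘from : ∀ p → to (from p) ≡ p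
  to∘from (r , mkPO Q _ _ _) = cong₂ _,_ r'≡r
      (PartialOrder-ext (trans (cong (λ s → removeRoot s (addRoot r Q)) r'≡r) (removeRoot-addRoot r Q)))
    where
    found = findRoot (addRoot r Q) (r , addRoot-root r Q)
    r'≡r = root-unique r Q (proj₁ found) (proj₂ found)
  from∘to : ∀ p → from (to p) ≡ p
  from∘to (mkRootedOrder R rf an tr rt) =
    RootedOrder-ext (addRoot-removeRoot (proj₁ found) R (λ x y p q → fin-irr (an x y p q)) (proj₂ found))
    where found = findRoot R rt

Fin-cong : ∀ {a b} → a ≡ b → Fin a ↔ Fin b
Fin-cong refl = ↔-refl

When-cong : ∀ b {X Y : Set} → (b ≡ true → X ↔ Y) → When b X ↔ When b Y
When-cong true f = f refl
When-cong false f = ↔-refl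

ΠSub-cong : ∀ {n} {F G : Subset n → Set} → (∀ A → F A ↔ G A) → ΠSub n F ↔ ΠSub n G
ΠSub-cong {zero} f = f []
ΠSub-cong {suc n} f = ΠSub-cong (λ A → f (false ∷ A)) ×-↔ ΠSub-cong (λ A → f (true ∷ A))

product-allSubsets : ∀ {n} (f : Subset (suc n) → ℕ) →
  product (map f (allSubsets (suc n))) ≡
  product (map (λ A → f (false ∷ A)) (allSubsets n)) * product (map (λ A → f (true ∷ A)) (allSubsets n))
product-allSubsets {n} f = begin
    product (map f (map (false ∷_) (allSubsets n) Data.List.++ map (true ∷_) (allSubsets n)))
  ≡⟨ cong product (map-++ f (map (false ∷_) (allSubsets n)) (map (true ∷_) (allSubsets n))) ⟩
    product (map f (map (false ∷_) (allSubsets n)) Data.List.++ map f (map (true ∷_) (allSubsets n)))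
  ≡⟨ product-++ (map f (map (false ∷_) (allSubsets n))) (map f (map (true ∷_) (allSubsets n))) ⟩
    product (map f (map (false ∷_) (allSubsets n))) * product (map f (map (true ∷_) (allSubsets n)))
  ≡⟨ cong₂ _*_ (cong product (sym (map-∘ (allSubsets n)))) (cong product (sym (map-∘ (allSubsets n)))) ⟩
    product (map (λ A → f (false ∷ A)) (allSubsets n)) * product (map (λ A → f (true ∷ A)) (allSubsets n))
  ∎
  where open ≡-Reasoning

Fin-product : ∀ {n} (f : Subset n → ℕ) → Fin (product (map f (allSubsets n))) ↔ ΠSub n (λ A → Fin (f A))
Fin-product {zero} f = Fin-cong (*-identityʳ (f []))
Fin-product {suc n} f = ↔-trans (Fin-cong (product-allSubsets f))
  (↔-trans *↔× (Fin-product (λ A → f (false ∷ A)) ×-↔ Fin-product (λ A → f (true ∷ A))))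

Fin-if : ∀ b x y → Fin (if b then x * y else 1) ↔ When b (Fin x × Fin y)
Fin-if true x y = *↔×
Fin-if false x y = 1↔⊤

Σ-Fin-suc : ∀ {m} (G : Fin (suc m) → Set) → Σ (Fin (suc m)) G ↔ (G zero ⊎ Σ (Fin m) (λ i → G (suc i)))
Σ-Fin-suc {m} G = mk↔ₛ′ to from to∘from from∘to
  where
  to : Σ (Fin (suc m)) G → G zero ⊎ Σ (Fin m) (λ i → G (suc i))
  to (zero , g) = inj₁ g
  to (suc i , g) = inj₂ (i , g)
  from : G zero ⊎ Σ (Fin m) (λ i → G (suc i)) → Σ (Fin (suc m)) G
  from (inj₁ g) = zero , g
  from (inj₂ (i , g)) = suc i , g
  to∘from : ∀ y → to (from y) ≡ y
  to∘from (inj₁ g) = refl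
  to∘from (inj₂ (i , g)) = refl
  from∘to : ∀ x → from (to x) ≡ x
  from∘to (zero , g) = refl
  from∘to (suc i , g) = refl

Fin-sum : ∀ m (g : Fin m → ℕ) → Fin (sum (tabulate g)) ↔ Σ (Fin m) (λ i → Fin (g i))
Fin-sum zero g = mk↔ₛ′ (λ ()) (λ { (() , _) }) (λ { (() , _) }) (λ ())
Fin-sum (suc m) g =
  ↔-trans +↔⊎ (↔-trans (↔-refl ⊎-↔ Fin-sum m (λ i → g (suc i))) (↔-sym (Σ-Fin-suc (λ i → Fin (g i)))))

RootedOn↔Fin : (P : ℕ → ℕ) → (∀ k → PartialOrder k ↔ Fin (P k)) →
  ∀ {n} (A : Subset n) → nontrivial A ≡ true →
  RootedOn A ↔ (Fin ∣ A ∣ × Fin (P (∣ A ∣ ∸ 1)))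
RootedOn↔Fin P count-P A big = ↔-trans (RootedOn↔RootedOrder A) (split ∣ A ∣ big)
  where
  split : ∀ k → (1 <ᵇ k) ≡ true → RootedOrder k ↔ (Fin k × Fin (P (k ∸ 1)))
  split (suc k) _ = ↔-trans (RootedOrder↔Root×PartialOrder k) (↔-refl ×-↔ count-P k)

BlockOrders↔Fin : (P : ℕ → ℕ) → (∀ k → PartialOrder k ↔ Fin (P k)) → ∀ {n} (𝒫 : Partition n) →
  BlockOrders (Partition.blocks 𝒫) ↔ Fin (weight P 𝒫)
BlockOrders↔Fin P count-P {n} 𝒫 = begin
    ΠSub n (λ A → When (bigBlock 𝒫ᵇ A) (RootedOn A))
  ↔⟨ ΠSub-cong (λ A → When-cong (bigBlock 𝒫ᵇ A) (λ big →
       RootedOn↔Fin P count-P A (∧-trueʳ {memb 𝒫ᵇ A} big))) ⟩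
    ΠSub n (λ A → When (bigBlock 𝒫ᵇ A) (Fin ∣ A ∣ × Fin (P (∣ A ∣ ∸ 1))))
  ↔⟨ ΠSub-cong (λ A → ↔-sym (Fin-if (bigBlock 𝒫ᵇ A) ∣ A ∣ (P (∣ A ∣ ∸ 1)))) ⟩
    ΠSub n (λ A → Fin (if bigBlock 𝒫ᵇ A then ∣ A ∣ * P (∣ A ∣ ∸ 1) else 1))
  ↔⟨ ↔-sym (Fin-product (λ A → if bigBlock 𝒫ᵇ A then ∣ A ∣ * P (∣ A ∣ ∸ 1) else 1)) ⟩
    Fin (weight P 𝒫)
  ∎
  where
  open EquationalReasoning
  𝒫ᵇ = Partition.blocks 𝒫

theorem2 : (n : ℕ) → 1 ≤ n →
    (P : ℕ → ℕ) → (∀ k → PartialOrder k ↔ Fin (P k)) →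
    (m : ℕ) → (e : Partition n ↔ Fin m) →
    ZeroDimT₀Topology n ↔ Fin (sum (tabulate (λ i → weight P (Inverse.from e i))))
theorem2 n n≥1 P count-P m e = begin
    ZeroDimT₀Topology n
  ↔⟨ ZeroDimT₀↔UMinOrder n n≥1 ⟩
    UMinOrder n
  ↔⟨ UMinOrder↔PartitionWithOrders n ⟩
    Σ (Partition n) (λ 𝒫 → BlockOrders (Partition.blocks 𝒫))
  ↔⟨ Σ-↔ ↔-refl (λ {𝒫} → BlockOrders↔Fin P count-P 𝒫) ⟩
    Σ (Partition n) (λ 𝒫 → Fin (weight P 𝒫))
  ↔⟨ Σ-↔ e (λ {𝒫} → Fin-cong (cong (weight P) (sym (Inverse.strictlyInverseʳ e 𝒫)))) ⟩
    Σ (Fin m) (λ i → Fin (weight P (Inverse.from e i)))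
  ↔⟨ ↔-sym (Fin-sum m (λ i → weight P (Inverse.from e i))) ⟩
    Fin (sum (tabulate (λ i → weight P (Inverse.from e i))))
  ∎
  where open EquationalReasoning
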